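{- Let $n>1$ be an integer every prime divisor of which is at least $7$, and let $A=U(n)^2$. Let $p$ be a prime divisor of $n$, $n'=n/p$ and $A'=U(n')^2$. Let $S_1':(u_1,\ldots,u_k)$, $S_2':(v_1,\ldots,v_k)$ and $S_3':(w_1,\ldots,w_k)$ be $A'$-extremal sequences in $\mathbb{Z}_{n'}$. Let $x^*,x^{**}\in\mathbb{Z}_n$ be such that the image of the sequence $(x^*,x^{**})$ under the natural map $\mathbb{Z}_n\to\mathbb{Z}_p$ has no $Q_p$-weighted zero-sum subsequence. Let $S:(p\,u_1,\ldots,p\,u_k,\,x^*,\,p\,v_1,\ldots,p\,v_k,\,x^{**},\,p\,w_1,\ldots,p\,w_k)$. Then $S$ is an $A$-extremal sequence in $\mathbb{Z}_n$.
   Context: For an integer $m\ge 1$, $\mathbb{Z}_m=\mathbb{Z}/m\mathbb{Z}$, $U(m)$ is its group of units and $U(m)^j=\{x^j: x\in U(m)\}$. For an odd prime $p$, $Q_p=U(p)^2$. The natural map $\mathbb{Z}_n\to\mathbb{Z}_m$ (for $m\mid n$) is $a+n\mathbb{Z}\mapsto a+m\mathbb{Z}$. For $B\subseteq\mathbb{Z}_m\setminus\{0\}$, a sequence $(x_1,\ldots,x_k)$ ($k\ge1$) in $\mathbb{Z}_m$ is a $B$-weighted zero-sum sequence if there exist $b_1,\ldots,b_k\in B$ with $b_1x_1+\cdots+b_kx_k=0$; a subsequence is any nonempty subsequence. A subsequence of consecutive terms is a nonempty block $(x_i,\ldots,x_j)$. $C_B(m)$ is the least positive integer $k$ such that every sequence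 of length $k$ in $\mathbb{Z}_m$ has a $B$-weighted zero-sum subsequence of consecutive terms. A sequence in $\mathbb{Z}_m$ is $B$-extremal if it has length $C_B(m)-1$ and has no $B$-weighted zero-sum subsequence of consecutive terms. For $u\in\mathbb{Z}_{n'}$, $p\,u$ is the element of $\mathbb{Z}_n$ obtained by multiplying an integer representative of $u$ by $p$. -}

module Defs where

open import Data.Nat using (ℕ; zero; suc; _+_; _*_; _≤_; _<_; NonZero; z<s)
open import Data.Nat.Base using (>-nonZero)
open import Data.Nat.Properties using (<-trans)
open import Data.Nat.DivMod using (_%_; m%n<n)
open import Data.Fin using (Fin; toℕ; fromℕ<)
open import Data.List using (List; []; _∷_; _++_; length; zipWith)
open import Data.Nat.ListAction using (sum)
open import Data.List.Relation.Unary.All using (All)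
open import Data.List.Relation.Binary.Sublist.Propositional using (_⊆_)
open import Data.Product using (Σ; ∃; _×_; _,_)
open import Relation.Binary.PropositionalEquality using (_≡_; _≢_)
open import Relation.Nullary using (¬_)

-- Z_m is modelled as Fin m (canonical representatives 0..m-1);
-- arithmetic is done on representatives in ℕ and compared modulo m.

_≡_[mod_] : ℕ → ℕ → ℕ → Set
a ≡ b [mod m ] = ∃ λ q → ∃ λ r → a + q * m ≡ b + r * m

red : (m : ℕ) → NonZero m → ℕ → Fin m
red m nz a = fromℕ< (m%n<n a m {{nz}})

1<⇒nonZero : ∀ {n} → 1 < n → NonZero n
1<⇒nonZero h = >-nonZero (<-trans z<s h)

IsUnit : (m : ℕ) → Fin m → Set
IsUnit m x = ∃ λ (y : Fin m) → (toℕ x * toℕ y) ≡ 1 [mod m ]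

-- U(m)^2 = { x^2 : x ∈ U(m) }, as a predicate on Z_m
-- (for an odd prime p, Q_p = SqUnits p)
SqUnits : (m : ℕ) → Fin m → Set
SqUnits m z = ∃ λ (x : Fin m) → IsUnit m x × (toℕ z ≡ toℕ x * toℕ x [mod m ])

wsum : ∀ {m} → List (Fin m) → List (Fin m) → ℕ
wsum bs xs = sum (zipWith (λ b x → toℕ b * toℕ x) bs xs)

WZS : (m : ℕ) → (Fin m → Set) → List (Fin m) → Set
WZS m B xs = (xs ≢ []) × (∃ λ (bs : List (Fin m)) →
  (length bs ≡ length xs) × All B bs × (wsum bs xs ≡ 0 [mod m ]))

HasWZSBlock : (m : ℕ) → (Fin m → Set) → List (Fin m) → Set
HasWZSBlock m B xs = ∃ λ (as : List (Fin m)) → ∃ λ (ys : List (Fin m)) → ∃ λ (cs : List (Fin m)) →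
  (xs ≡ as ++ ys ++ cs) × WZS m B ys

HasWZSSub : (m : ℕ) → (Fin m → Set) → List (Fin m) → Set
HasWZSSub m B xs = ∃ λ (ys : List (Fin m)) → (ys ⊆ xs) × WZS m B ys

AllHaveBlock : (m : ℕ) → (Fin m → Set) → ℕ → Set
AllHaveBlock m B k = (xs : List (Fin m)) → length xs ≡ k → HasWZSBlock m B xs

IsC : (m : ℕ) → (Fin m → Set) → ℕ → Set
IsC m B c = (1 ≤ c) × AllHaveBlock m B c ×
  ((k : ℕ) → 1 ≤ k → k < c → ¬ AllHaveBlock m B k)

Extremal : (m : ℕ) → (Fin m → Set) → List (Fin m) → Set
Extremal m B xs = (∃ λ c → IsC m B c × suc (length xs) ≡ c) × ¬ HasWZSBlock m B xs

{-# OPTIONS --safe #-}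
-- Lower bound: a zero-sum block of S either meets x* or x**, and then its entries prime to p
-- form a nonempty subsequence of (x*, x**) that is Q_p-weighted zero-sum modulo p; or it lies
-- inside one run (p u_i), (p v_i) or (p w_i), and dividing by p gives a zero-sum block of an
-- extremal sequence of ℤ_n′.
-- Upper bound: with k + 1 = C_A′(n′), a sequence of length 3(k + 1) in ℤ_n splits into k + 1
-- consecutive segments, each a single multiple of p or containing exactly three entries prime
-- to p. As p ≥ 7, every form a x² + b y² + c z² with p ∤ abc has a zero modulo p with p ∤ xyz,
-- so each segment has an A-weighted sum p z_j; a zero-sum block of (z_j) in ℤ_n′ lifts to one
-- in ℤ_n. Hence C_A(n) = 3(k + 1) = |S| + 1.
module Submission where

module Congruence where

  open import Defs
  open import Data.Nat
  open import Data.Nat.Properties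
  open import Data.Nat.DivMod
  open import Data.Nat.Divisibility
  open import Data.Fin using (Fin; toℕ)
  import Data.Fin.Properties as Fin
  open import Data.Integer as ℤ using (+_)
  import Data.Integer.Properties as ℤ
  import Data.Integer.Divisibility.Signed as ℤ
  open import Data.Product using (_,_)
  open import Data.Sum using (inj₁; inj₂)
  open import Relation.Binary.Bundles using (Setoid)
  open import Relation.Binary.PropositionalEquality

  -- A record rather than the bare equation a % m ≡ b % m, so that a, b and m are inferable.
  infix 4 _≈_⟨mod_⟩
  record _≈_⟨mod_⟩ (a b m : ℕ) .{{_ : NonZero m}} : Set where
    constructor mk
    field %-≡ : a % m ≡ b % m
  open _≈_⟨mod_⟩ public

  module _ {m : ℕ} .{{_ : NonZero m}} where
    open ≡-Reasoning

    ≈-reflexive : ∀ {a b} → a ≡ b → a ≈ b ⟨mod m ⟩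
    ≈-reflexive refl = mk refl

    ≈-refl : ∀ {a} → a ≈ a ⟨mod m ⟩
    ≈-refl = mk refl

    ≈-sym : ∀ {a b} → a ≈ b ⟨mod m ⟩ → b ≈ a ⟨mod m ⟩
    ≈-sym (mk e) = mk (sym e)

    ≈-trans : ∀ {a b c} → a ≈ b ⟨mod m ⟩ → b ≈ c ⟨mod m ⟩ → a ≈ c ⟨mod m ⟩
    ≈-trans (mk e) (mk f) = mk (trans e f)

    +-cong-≈ : ∀ {a a′ b b′} → a ≈ a′ ⟨mod m ⟩ → b ≈ b′ ⟨mod m ⟩ → a + b ≈ a′ + b′ ⟨mod m ⟩
    +-cong-≈ {a} {a′} {b} {b′} (mk e) (mk f) = mk (begin
      (a + b) % m             ≡⟨ %-distribˡ-+ a b m ⟩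
      (a % m + b % m) % m     ≡⟨ cong₂ (λ x y → (x + y) % m) e f ⟩
      (a′ % m + b′ % m) % m   ≡⟨ %-distribˡ-+ a′ b′ m ⟨
      (a′ + b′) % m           ∎)

    *-cong-≈ : ∀ {a a′ b b′} → a ≈ a′ ⟨mod m ⟩ → b ≈ b′ ⟨mod m ⟩ → a * b ≈ a′ * b′ ⟨mod m ⟩
    *-cong-≈ {a} {a′} {b} {b′} (mk e) (mk f) = mk (begin
      (a * b) % m               ≡⟨ %-distribˡ-* a b m ⟩
      (a % m * (b % m)) % m     ≡⟨ cong₂ (λ x y → (x * y) % m) e f ⟩
      (a′ % m * (b′ % m)) % m   ≡⟨ %-distribˡ-* a′ b′ m ⟨
      (a′ * b′) % m             ∎)

    %-≈ : ∀ a → a % m ≈ a ⟨mod m ⟩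
    %-≈ a = mk (m%n%n≡m%n a m)

    +k*m-≈ : ∀ a k → a + k * m ≈ a ⟨mod m ⟩
    +k*m-≈ a k = mk ([m+kn]%n≡m%n a k m)

    0%m≡0 : 0 % m ≡ 0
    0%m≡0 = m<n⇒m%n≡m (n≢0⇒n>0 (≢-nonZero⁻¹ m))

    ≈0⇒∣ : ∀ {a} → a ≈ 0 ⟨mod m ⟩ → m ∣ a
    ≈0⇒∣ {a} (mk e) = m%n≡0⇒n∣m a m (trans e 0%m≡0)

    ∣⇒≈0 : ∀ {a} → m ∣ a → a ≈ 0 ⟨mod m ⟩
    ∣⇒≈0 {a} d = mk (trans (n∣m⇒m%n≡0 a m d) (sym 0%m≡0))

    ≈⇒≡[mod] : ∀ {a b} → a ≈ b ⟨mod m ⟩ → a ≡ b [mod m ]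
    ≈⇒≡[mod] {a} {b} (mk e) = b / m , a / m , (begin
      a + b / m * m                     ≡⟨ cong (_+ b / m * m) (m≡m%n+[m/n]*n a m) ⟩
      a % m + a / m * m + b / m * m     ≡⟨ +-assoc (a % m) _ _ ⟩
      a % m + (a / m * m + b / m * m)   ≡⟨ cong₂ _+_ e (+-comm (a / m * m) _) ⟩
      b % m + (b / m * m + a / m * m)   ≡⟨ +-assoc (b % m) _ _ ⟨
      b % m + b / m * m + a / m * m     ≡⟨ cong (_+ a / m * m) (m≡m%n+[m/n]*n b m) ⟨
      b + a / m * m                     ∎)

    ≡[mod]⇒≈ : ∀ {a b} → a ≡ b [mod m ] → a ≈ b ⟨mod m ⟩
    ≡[mod]⇒≈ {a} {b} (q , r , e) =
      ≈-trans (≈-sym (+k*m-≈ a q)) (≈-trans (≈-reflexive e) (+k*m-≈ b r))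

    ∣∸⇒≈ : ∀ {a b} → a ≤ b → m ∣ b ∸ a → b ≈ a ⟨mod m ⟩
    ∣∸⇒≈ {a} {b} a≤b (divides k eq) =
      ≈-trans (≈-reflexive (trans (sym (m+[n∸m]≡n a≤b)) (cong (λ x → a + x) eq))) (+k*m-≈ a k)

    ∣-⇒≈ : ∀ {a b} → + m ℤ.∣ (+ a ℤ.- + b) → a ≈ b ⟨mod m ⟩
    ∣-⇒≈ {a} {b} d with ≤-total a b | subst (λ x → m ∣ ℤ.∣ x ∣) (ℤ.m-n≡m⊖n a b) (ℤ.∣⇒∣ᵤ d)
    ... | inj₁ a≤b | m∣a⊖b = ≈-sym (∣∸⇒≈ a≤b (subst (m ∣_) (ℤ.∣⊖∣-≤ a≤b) m∣a⊖b))
    ... | inj₂ b≤a | m∣a⊖b = ∣∸⇒≈ b≤a (subst (m ∣_) (trans (ℤ.∣m⊖n∣≡∣n⊖m∣ a b) (ℤ.∣⊖∣-≤ b≤a)) m∣a⊖b)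

    ≈-setoid : Setoid _ _
    ≈-setoid = record
      { Carrier = ℕ
      ; _≈_ = _≈_⟨mod m ⟩
      ; isEquivalence = record { refl = ≈-refl ; sym = ≈-sym ; trans = ≈-trans }
      }

  module ≈-Reasoning (m : ℕ) .{{_ : NonZero m}} where
    open import Relation.Binary.Reasoning.Setoid (≈-setoid {m}) public

  ≈-divisor : ∀ {m} d .{{_ : NonZero m}} .{{_ : NonZero d}} → d ∣ m →
              ∀ {a b} → a ≈ b ⟨mod m ⟩ → a ≈ b ⟨mod d ⟩
  ≈-divisor {m} d d∣m {a} {b} (mk e) = mk (begin
    a % d       ≡⟨ m∣n⇒o%n%m≡o%m d m a d∣m ⟨
    a % m % d   ≡⟨ cong (_% d) e ⟩
    b % m % d   ≡⟨ m∣n⇒o%n%m≡o%m d m b d∣m ⟩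
    b % d       ∎)
    where open ≡-Reasoning

  toℕ-red : ∀ m (nz : NonZero m) a → toℕ (red m nz a) ≡ _%_ a m {{nz}}
  toℕ-red m nz a = Fin.toℕ-fromℕ< _

  red-≈ : ∀ m (nz : NonZero m) a → _≈_⟨mod_⟩ (toℕ (red m nz a)) a m {{nz}}
  red-≈ m nz a = ≈-trans {{nz}} (≈-reflexive {{nz}} (toℕ-red m nz a)) (%-≈ {{nz}} a)

module DiagonalTernaryForms where

  open Congruence
  open import Data.Nat as ℕ using (ℕ; zero; suc; z<s; NonZero)
  import Data.Nat.Properties as ℕ
  open import Data.Nat.DivMod using (_%_; _/_; m≡m%n+[m/n]*n; m%n<n; m<n⇒m%n≡m)
  open import Data.Nat.Divisibility using (>⇒∤) renaming (_∣_ to _∣ₙ_; _∤_ to _∤ₙ_; divides to dividesₙ)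
  open import Data.Nat.Primality using (Prime; euclidsLemma; prime⇒irreducible; prime⇒nonZero)
  open import Data.Integer using (ℤ; +_; -[1+_]; _+_; _*_; _-_; -_) renaming (∣_∣ to abs)
  import Data.Integer.Properties as ℤ
  open import Data.Integer.DivMod using (_%ℕ_; _/ℕ_; n%ℕd<d; a≡a%ℕn+[a/ℕn]*n)
  open import Data.Integer.Divisibility.Signed
    using (_∣_; _∣?_; divides; ∣ᵤ⇒∣; ∣⇒∣ᵤ; ∣m∣n⇒∣m+n; ∣m+n∣m⇒∣n; ∣m∣n⇒∣m-n; ∣m⇒∣-m; ∣m⇒∣m*n; ∣n⇒∣m*n)
  open import Data.Integer.Tactic.RingSolver using (solve-∀)
  open import Data.Fin using (Fin; toℕ; fromℕ<; splitAt; join) renaming (_<_ to _<ᶠ_)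
  import Data.Fin.Properties as Fin
  open import Data.Product using (∃-syntax; _×_; _,_)
  open import Data.Sum using (_⊎_; inj₁; inj₂)
  open import Data.Empty using (⊥; ⊥-elim)
  open import Function using (_∘_)
  open import Relation.Binary.PropositionalEquality
  open import Relation.Nullary using (¬_; yes; no; contradiction)

  prime-∣-* : ∀ {p} → Prime p → ∀ x y → + p ∣ x * y → + p ∣ x ⊎ + p ∣ y
  prime-∣-* {p} pr x y d with euclidsLemma (abs x) (abs y) pr (subst (p ∣ₙ_) (ℤ.abs-* x y) (∣⇒∣ᵤ d))
  ... | inj₁ e = inj₁ (∣ᵤ⇒∣ e)
  ... | inj₂ e = inj₂ (∣ᵤ⇒∣ e)

  %ℕ-≡⇒∣- : ∀ {d} .{{_ : NonZero d}} x y → x %ℕ d ≡ y %ℕ d → + d ∣ x - y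
  %ℕ-≡⇒∣- {d} x y e = divides (x /ℕ d - y /ℕ d) (begin
    x - y
      ≡⟨ cong₂ _-_ (a≡a%ℕn+[a/ℕn]*n x d) (a≡a%ℕn+[a/ℕn]*n y d) ⟩
    (+ (x %ℕ d) + x /ℕ d * + d) - (+ (y %ℕ d) + y /ℕ d * + d)
      ≡⟨ cong (λ r → (+ (x %ℕ d) + x /ℕ d * + d) - (+ r + y /ℕ d * + d)) (sym e) ⟩
    (+ (x %ℕ d) + x /ℕ d * + d) - (+ (x %ℕ d) + y /ℕ d * + d)
      ≡⟨ cancel (+ (x %ℕ d)) (x /ℕ d) (y /ℕ d) (+ d) ⟩
    (x /ℕ d - y /ℕ d) * + d ∎)
    where
    open ≡-Reasoning
    cancel : ∀ r u v d → (r + u * d) - (r + v * d) ≡ (u - v) * d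
    cancel = solve-∀

  module UnitSolutions {p : ℕ} (pr : Prime p) (7≤p : 7 ℕ.≤ p) where

    instance
      p≢0 : NonZero p
      p≢0 = prime⇒nonZero pr

    p∤_ : ℤ → Set
    p∤ x = ¬ (+ p ∣ x)

    UnitSolution : ℤ → ℤ → ℤ → Set
    UnitSolution a b c = ∃[ x ] ∃[ y ] ∃[ z ] p∤ x × p∤ y × p∤ z ×
      + p ∣ a * (x * x) + b * (y * y) + c * (z * z)

    small∤ : ∀ d .{{_ : NonZero d}} → d ℕ.< 7 → p∤ (+ d)
    small∤ d d<7 p∣d = >⇒∤ (ℕ.<-≤-trans d<7 7≤p) (∣⇒∣ᵤ p∣d)

    8∤ : p∤ (+ 8)
    8∤ p∣8 with prime-∣-* pr (+ 2) (+ 4) p∣8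
    ... | inj₁ p∣2 = small∤ 2 (ℕ.m<m+n 2 z<s) p∣2
    ... | inj₂ p∣4 = small∤ 4 (ℕ.m<m+n 4 z<s) p∣4

    ∤-* : ∀ {x y} → p∤ x → p∤ y → p∤ (x * y)
    ∤-* {x} {y} p∤x p∤y p∣xy with prime-∣-* pr x y p∣xy
    ... | inj₁ p∣x = p∤x p∣x
    ... | inj₂ p∣y = p∤y p∣y

    p-odd : ∃[ h ] p ≡ suc (h ℕ.+ h)
    p-odd with p % 2 | m≡m%n+[m/n]*n p 2 | m%n<n p 2
    ... | 0 | p≡[p/2]*2 | _ with prime⇒irreducible pr (dividesₙ (p / 2) p≡[p/2]*2)
    ...   | inj₁ ()
    ...   | inj₂ 2≡p = contradiction (subst (7 ℕ.≤_) (sym 2≡p) 7≤p) λ { (ℕ.s≤s (ℕ.s≤s ())) }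
    p-odd | 1 | p≡1+[p/2]*2 | _ =
      p / 2 , trans p≡1+[p/2]*2 (cong suc (trans (ℕ.*-comm (p / 2) 2) (cong (p / 2 ℕ.+_) (ℕ.+-identityʳ (p / 2)))))
    p-odd | suc (suc _) | _ | ℕ.s≤s (ℕ.s≤s ())

    ∣⇒≡0 : ∀ {d} → d ℕ.< p → + p ∣ + d → d ≡ 0
    ∣⇒≡0 {zero} _ _ = refl
    ∣⇒≡0 {suc d} d<p p∣d = ⊥-elim (>⇒∤ d<p (∣⇒∣ᵤ p∣d))

    module _ {h : ℕ} (p≡1+2h : p ≡ suc (h ℕ.+ h)) where

      +<p : ∀ {x y} → x ℕ.≤ h → y ℕ.≤ h → x ℕ.+ y ℕ.< p
      +<p x≤h y≤h = subst (_ ℕ.<_) (sym p≡1+2h) (ℕ.s≤s (ℕ.+-mono-≤ x≤h y≤h))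

      ≤h⇒<p : ∀ {x} → x ℕ.≤ h → x ℕ.< p
      ≤h⇒<p {x} x≤h = ℕ.≤-<-trans (ℕ.m≤m+n x 0) (+<p x≤h ℕ.z≤n)

      sq-injective : ∀ {a} → p∤ a → ∀ {x y} → x ℕ.≤ h → y ℕ.≤ h →
                     + p ∣ a * (+ x * + x - + y * + y) → x ≡ y
      sq-injective {a} p∤a {x} {y} x≤h y≤h p∣ with prime-∣-* pr a _ p∣
      ... | inj₁ p∣a = ⊥-elim (p∤a p∣a)
      ... | inj₂ p∣x²-y² with prime-∣-* pr (+ x - + y) (+ x + + y) (subst (+ p ∣_) (factor (+ x) (+ y)) p∣x²-y²)
        where
        factor : ∀ x y → x * x - y * y ≡ (x - y) * (x + y)
        factor = solve-∀
      ...   | inj₂ p∣x+y = trans (ℕ.m+n≡0⇒m≡0 x x+y≡0) (sym (ℕ.m+n≡0⇒n≡0 x x+y≡0))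
        where
        x+y≡0 : x ℕ.+ y ≡ 0
        x+y≡0 = ∣⇒≡0 (+<p x≤h y≤h) (subst (+ p ∣_) (sym (ℤ.pos-+ x y)) p∣x+y)
      ...   | inj₁ p∣x-y = begin
        x       ≡⟨ m<n⇒m%n≡m (≤h⇒<p x≤h) ⟨
        x % p   ≡⟨ %-≡ (∣-⇒≈ p∣x-y) ⟩
        y % p   ≡⟨ m<n⇒m%n≡m (≤h⇒<p y≤h) ⟩
        y       ∎
        where open ≡-Reasoning

      -- The h + 1 values −a s² and the h + 1 values b t² + c cannot be p + 1 distinct residues.
      two-squares : ∀ {a b} c → p∤ a → p∤ b → ∃[ s ] ∃[ t ] + p ∣ a * (s * s) + b * (t * t) + c
      two-squares {a} {b} c p∤a p∤b = from-pigeonhole (Fin.pigeonhole p<2[h+1] residue)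
        where
        Solvable : Set
        Solvable = ∃[ s ] ∃[ t ] + p ∣ a * (s * s) + b * (t * t) + c

        sq : Fin (suc h) → ℤ
        sq i = + toℕ i * + toℕ i

        value : Fin (suc h) ⊎ Fin (suc h) → ℤ
        value (inj₁ s) = - (a * sq s)
        value (inj₂ t) = b * sq t + c

        residue : Fin (suc h ℕ.+ suc h) → Fin p
        residue i = fromℕ< (n%ℕd<d (value (splitAt (suc h) i)) p)

        p<2[h+1] : p ℕ.< suc h ℕ.+ suc h
        p<2[h+1] = subst (ℕ._< suc h ℕ.+ suc h) (sym p≡1+2h) (ℕ.s≤s (ℕ.≤-reflexive (sym (ℕ.+-suc h h))))

        splitAt-injective : ∀ i j → splitAt (suc h) i ≡ splitAt (suc h) j → i ≡ j
        splitAt-injective i j e = trans (sym (Fin.join-splitAt (suc h) (suc h) i))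
          (trans (cong (join (suc h) (suc h)) e) (Fin.join-splitAt (suc h) (suc h) j))

        ≤h : (s : Fin (suc h)) → toℕ s ℕ.≤ h
        ≤h s = ℕ.≤-pred (Fin.toℕ<n s)

        same-square : ∀ {d} → p∤ d → ∀ s t → + p ∣ d * (sq s - sq t) → s ≡ t
        same-square p∤d s t p∣ = Fin.toℕ-injective (sq-injective p∤d (≤h s) (≤h t) p∣)

        collision : ∀ u v → u ≢ v → + p ∣ value u - value v → Solvable
        collision (inj₁ s) (inj₁ t) s≢t p∣ =
          ⊥-elim (s≢t (cong inj₁ (sym (same-square p∤a t s (subst (+ p ∣_) (diff a (sq s) (sq t)) p∣)))))
          where
          diff : ∀ a x y → - (a * x) - - (a * y) ≡ a * (y - x)
          diff = solve-∀
        collision (inj₂ s) (inj₂ t) s≢t p∣ =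
          ⊥-elim (s≢t (cong inj₂ (same-square p∤b s t (subst (+ p ∣_) (diff b c (sq s) (sq t)) p∣))))
          where
          diff : ∀ b c x y → (b * x + c) - (b * y + c) ≡ b * (x - y)
          diff = solve-∀
        collision (inj₁ s) (inj₂ t) _ p∣ =
          + toℕ s , + toℕ t , subst (+ p ∣_) (diff a b c (sq s) (sq t)) (∣m⇒∣-m p∣)
          where
          diff : ∀ a b c x y → - (- (a * x) - (b * y + c)) ≡ a * x + b * y + c
          diff = solve-∀
        collision (inj₂ t) (inj₁ s) _ p∣ =
          + toℕ s , + toℕ t , subst (+ p ∣_) (diff a b c (sq s) (sq t)) p∣
          where
          diff : ∀ a b c x y → (b * y + c) - - (a * x) ≡ a * x + b * y + c
          diff = solve-∀

        from-pigeonhole : ∃[ i ] ∃[ j ] i <ᶠ j × residue i ≡ residue j → Solvable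
        from-pigeonhole (i , j , i<j , ρi≡ρj) =
          collision (splitAt (suc h) i) (splitAt (suc h) j)
            (λ e → ℕ.<-irrefl (cong toℕ (splitAt-injective i j e)) i<j)
            (%ℕ-≡⇒∣- (value (splitAt (suc h) i)) (value (splitAt (suc h) j))
              (trans (sym (Fin.toℕ-fromℕ< _)) (trans (cong toℕ ρi≡ρj) (Fin.toℕ-fromℕ< _))))

    module ChoiceOfK {a : ℤ} (b : ℤ) (p∤a : p∤ a) where

      Bad : ℤ → Set
      Bad k = + p ∣ b - a * (k * k) ⊎ + p ∣ b + a * (k * k)

      classify : ∀ k → p∤ (b - a * (k * k)) × p∤ (b + a * (k * k)) ⊎ Bad k
      classify k with + p ∣? (b - a * (k * k)) | + p ∣? (b + a * (k * k))
      ... | yes p∣b-ak² | _ = inj₂ (inj₁ p∣b-ak²)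
      ... | no _ | yes p∣b+ak² = inj₂ (inj₂ p∣b+ak²)
      ... | no p∤b-ak² | no p∤b+ak² = inj₁ (p∤b-ak² , p∤b+ak²)

      minus-minus : ∀ i j → + p ∣ b - a * (i * i) → + p ∣ b - a * (j * j) → + p ∣ a * (j * j - i * i)
      minus-minus i j p∣i p∣j = subst (+ p ∣_) (diff a b i j) (∣m∣n⇒∣m-n p∣i p∣j)
        where
        diff : ∀ a b i j → (b - a * (i * i)) - (b - a * (j * j)) ≡ a * (j * j - i * i)
        diff = solve-∀

      plus-plus : ∀ i j → + p ∣ b + a * (i * i) → + p ∣ b + a * (j * j) → + p ∣ a * (j * j - i * i)
      plus-plus i j p∣i p∣j = subst (+ p ∣_) (diff a b i j) (∣m∣n⇒∣m-n p∣j p∣i)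
        where
        diff : ∀ a b i j → (b + a * (j * j)) - (b + a * (i * i)) ≡ a * (j * j - i * i)
        diff = solve-∀

      3∤ : p∤ (+ 3)
      3∤ = small∤ 3 (ℕ.m<m+n 3 z<s)

      5∤ : p∤ (+ 5)
      5∤ = small∤ 5 (ℕ.m<m+n 5 z<s)

      -- Two bad k of the same sign give p ∣ a (j² − i²) with j² − i² ∈ {3, 5, 8}.
      not-all-bad : Bad (+ 1) → Bad (+ 2) → Bad (+ 3) → ⊥
      not-all-bad (inj₁ m₁) (inj₁ m₂) _ = ∤-* p∤a 3∤ (minus-minus (+ 1) (+ 2) m₁ m₂)
      not-all-bad (inj₂ p₁) (inj₂ p₂) _ = ∤-* p∤a 3∤ (plus-plus (+ 1) (+ 2) p₁ p₂)
      not-all-bad (inj₁ m₁) (inj₂ _) (inj₁ m₃) = ∤-* p∤a 8∤ (minus-minus (+ 1) (+ 3) m₁ m₃)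
      not-all-bad (inj₁ _) (inj₂ p₂) (inj₂ p₃) = ∤-* p∤a 5∤ (plus-plus (+ 2) (+ 3) p₂ p₃)
      not-all-bad (inj₂ _) (inj₁ m₂) (inj₁ m₃) = ∤-* p∤a 5∤ (minus-minus (+ 2) (+ 3) m₂ m₃)
      not-all-bad (inj₂ p₁) (inj₁ _) (inj₂ p₃) = ∤-* p∤a 8∤ (plus-plus (+ 1) (+ 3) p₁ p₃)

      ∃-good-k : ∃[ k ] p∤ k × p∤ (b - a * (k * k)) × p∤ (b + a * (k * k))
      ∃-good-k with classify (+ 1) | classify (+ 2) | classify (+ 3)
      ... | inj₁ good | _ | _ = + 1 , small∤ 1 (ℕ.m<m+n 1 z<s) , good
      ... | inj₂ _ | inj₁ good | _ = + 2 , small∤ 2 (ℕ.m<m+n 2 z<s) , good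
      ... | inj₂ _ | inj₂ _ | inj₁ good = + 3 , small∤ 3 (ℕ.m<m+n 3 z<s) , good
      ... | inj₂ bad₁ | inj₂ bad₂ | inj₂ bad₃ = ⊥-elim (not-all-bad bad₁ bad₂ bad₃)

    open ChoiceOfK using (∃-good-k)

    scaling-identity : ∀ a b c x k →
      a * ((x * (b - a * (k * k))) * (x * (b - a * (k * k)))) + b * ((+ 2 * a * x * k) * (+ 2 * a * x * k))
        + c * ((b + a * (k * k)) * (b + a * (k * k)))
      ≡ (a * (x * x) + c) * ((b + a * (k * k)) * (b + a * (k * k)))
    scaling-identity a b c x k = begin
      a * (X * X) + b * (Y * Y) + c * (Z * Z)
        ≡⟨ cong₂ (λ u v → u + v + c * (Z * Z)) (first a x (b - V)) (second a b x k) ⟩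
      W * ((b - V) * (b - V)) + W * (+ 4 * b * V) + c * (Z * Z)
        ≡⟨ cong (_+ c * (Z * Z)) (sym (ℤ.*-distribˡ-+ W _ _)) ⟩
      W * ((b - V) * (b - V) + + 4 * b * V) + c * (Z * Z)
        ≡⟨ cong (λ u → W * u + c * (Z * Z)) (square-of-sum b V) ⟩
      W * (Z * Z) + c * (Z * Z)
        ≡⟨ ℤ.*-distribʳ-+ (Z * Z) W c ⟨
      (W + c) * (Z * Z) ∎
      where
      open ≡-Reasoning
      V W X Y Z : ℤ
      V = a * (k * k)
      W = a * (x * x)
      X = x * (b - V)
      Y = + 2 * a * x * k
      Z = b + V
      first : ∀ a x m → a * ((x * m) * (x * m)) ≡ a * (x * x) * (m * m)
      first = solve-∀
      second : ∀ a b x k → b * ((+ 2 * a * x * k) * (+ 2 * a * x * k)) ≡ a * (x * x) * (+ 4 * b * (a * (k * k)))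
      second = solve-∀
      square-of-sum : ∀ b v → (b - v) * (b - v) + + 4 * b * v ≡ (b + v) * (b + v)
      square-of-sum = solve-∀

    -- Multiplying a x² + c ≡ 0 by (b + a k²)² gives a solution whose coordinates are units.
    fix-up : ∀ {a c x} b → p∤ a → p∤ x → + p ∣ a * (x * x) + c → UnitSolution a b c
    fix-up {a} {c} {x} b p∤a p∤x p∣ with k , p∤k , p∤b-ak² , p∤b+ak² ← ∃-good-k b p∤a =
      x * (b - a * (k * k)) , + 2 * a * x * k , b + a * (k * k) ,
      ∤-* p∤x p∤b-ak² , ∤-* (∤-* (∤-* (small∤ 2 (ℕ.m<m+n 2 z<s)) p∤a) p∤x) p∤k , p∤b+ak² ,
      subst (+ p ∣_) (sym (scaling-identity a b c x k)) (∣m⇒∣m*n _ p∣)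

    swap-solution : ∀ {a b c} → UnitSolution b a c → UnitSolution a b c
    swap-solution {a} {b} {c} (x , y , z , p∤x , p∤y , p∤z , p∣) =
      y , x , z , p∤y , p∤x , p∤z , subst (+ p ∣_) (swap b a c x y z) p∣
      where
      swap : ∀ b a c x y z → b * (x * x) + a * (y * y) + c * (z * z) ≡ a * (y * y) + b * (x * x) + c * (z * z)
      swap = solve-∀

    unit-solution : ∀ {a b c} → p∤ a → p∤ b → p∤ c → UnitSolution a b c
    unit-solution {a} {b} {c} p∤a p∤b p∤c
      with h , p≡1+2h ← p-odd
      with s , t , p∣ ← two-squares {h} p≡1+2h c p∤a p∤b
      with + p ∣? s | + p ∣? t
    ... | no p∤s | no p∤t =
      s , t , + 1 , p∤s , p∤t , small∤ 1 (ℕ.m<m+n 1 z<s) , subst (+ p ∣_) (z≡1 a b c s t) p∣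
      where
      z≡1 : ∀ a b c x y → a * (x * x) + b * (y * y) + c ≡ a * (x * x) + b * (y * y) + c * (+ 1 * + 1)
      z≡1 = solve-∀
    ... | yes p∣s | yes p∣t =
      ⊥-elim (p∤c (∣m+n∣m⇒∣n p∣ (∣m∣n⇒∣m+n (∣n⇒∣m*n a (∣m⇒∣m*n s p∣s)) (∣n⇒∣m*n b (∣m⇒∣m*n t p∣t)))))
    ... | no p∤s | yes p∣t =
      fix-up b p∤a p∤s (subst (+ p ∣_) (drop-t a b c s t) (∣m∣n⇒∣m-n p∣ (∣n⇒∣m*n b (∣m⇒∣m*n t p∣t))))
      where
      drop-t : ∀ a b c s t → a * (s * s) + b * (t * t) + c - b * (t * t) ≡ a * (s * s) + c
      drop-t = solve-∀
    ... | yes p∣s | no p∤t =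
      swap-solution {a} {b} {c} (fix-up a p∤b p∤t (subst (+ p ∣_) (drop-s a b c s t) (∣m∣n⇒∣m-n p∣ (∣n⇒∣m*n a (∣m⇒∣m*n s p∣s)))))
      where
      drop-s : ∀ a b c s t → a * (s * s) + b * (t * t) + c - a * (s * s) ≡ b * (t * t) + c
      drop-s = solve-∀

  abs²≡² : ∀ x → + abs x * + abs x ≡ x * x
  abs²≡² (+ n) = refl
  abs²≡² -[1+ n ] = refl

  pos-*-abs² : ∀ a x → + (a ℕ.* (abs x ℕ.* abs x)) ≡ + a * (x * x)
  pos-*-abs² a x = trans (ℤ.pos-* a _) (cong (+ a *_) (trans (ℤ.pos-* (abs x) (abs x)) (abs²≡² x)))

  ternary-unit-solution : ∀ {p} → Prime p → 7 ℕ.≤ p → ∀ {a b c} → p ∤ₙ a → p ∤ₙ b → p ∤ₙ c →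
    ∃[ x ] ∃[ y ] ∃[ z ] p ∤ₙ x × p ∤ₙ y × p ∤ₙ z ×
      p ∣ₙ a ℕ.* (x ℕ.* x) ℕ.+ b ℕ.* (y ℕ.* y) ℕ.+ c ℕ.* (z ℕ.* z)
  ternary-unit-solution {p} pr 7≤p {a} {b} {c} p∤a p∤b p∤c =
    from-ℤ (unit-solution {+ a} {+ b} {+ c} (λ d → p∤a (∣⇒∣ᵤ d)) (λ d → p∤b (∣⇒∣ᵤ d)) (λ d → p∤c (∣⇒∣ᵤ d)))
    where
    open UnitSolutions pr 7≤p
    from-ℤ : UnitSolution (+ a) (+ b) (+ c) → ∃[ x ] ∃[ y ] ∃[ z ] p ∤ₙ x × p ∤ₙ y × p ∤ₙ z ×
      p ∣ₙ a ℕ.* (x ℕ.* x) ℕ.+ b ℕ.* (y ℕ.* y) ℕ.+ c ℕ.* (z ℕ.* z)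
    from-ℤ (x , y , z , p∤x , p∤y , p∤z , p∣) =
      abs x , abs y , abs z , p∤x ∘ ∣ᵤ⇒∣ , p∤y ∘ ∣ᵤ⇒∣ , p∤z ∘ ∣ᵤ⇒∣ , ∣⇒∣ᵤ (subst (+ p ∣_) (sym cast) p∣)
      where
      cast : + (a ℕ.* (abs x ℕ.* abs x) ℕ.+ b ℕ.* (abs y ℕ.* abs y) ℕ.+ c ℕ.* (abs z ℕ.* abs z))
           ≡ + a * (x * x) + + b * (y * y) + + c * (z * z)
      cast = trans (ℤ.pos-+ (a ℕ.* (abs x ℕ.* abs x) ℕ.+ b ℕ.* (abs y ℕ.* abs y)) (c ℕ.* (abs z ℕ.* abs z)))
        (cong₂ _+_ (trans (ℤ.pos-+ (a ℕ.* (abs x ℕ.* abs x)) (b ℕ.* (abs y ℕ.* abs y)))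
                          (cong₂ _+_ (pos-*-abs² a x) (pos-*-abs² b y)))
                   (pos-*-abs² c z))

module SquaresOfUnits where

  open import Defs
  open Congruence
  open import Data.Nat
  open import Data.Nat.Properties
  open import Data.Nat.Divisibility
  open import Data.Nat.Coprimality using (Coprime; coprime-Bézout; coprime-divisor) renaming (sym to sym-coprime)
  open import Data.Nat.DivMod using (_/_; [m+n]%n≡m%n; m≥n⇒m/n>0; m/n<m; m*[n/m]≡n)
  open import Data.Nat.GCD using (module Bézout)
  open import Data.Nat.Primality using (Prime; prime⇒irreducible; prime⇒nonZero; prime⇒nonTrivial; ¬prime[1])
  open import Data.Nat.Tactic.RingSolver using (solve-∀)
  open import Algebra.Properties.CommutativeSemigroup *-commutativeSemigroup using (interchange; xy∙z≈xz∙y)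
  open import Data.Fin using (Fin; toℕ)
  open import Data.Product using (∃-syntax; _×_; _,_)
  open import Data.Sum using (inj₁; inj₂)
  open import Data.Empty using (⊥-elim)
  open import Function using (_∘_; flip)
  open import Relation.Binary.PropositionalEquality
  open import Relation.Nullary using (yes; no)

  ∤⇒coprime : ∀ {p d} → Prime p → p ∤ d → Coprime d p
  ∤⇒coprime pr p∤d (e∣d , e∣p) with prime⇒irreducible pr e∣p
  ... | inj₁ e≡1 = e≡1
  ... | inj₂ refl = ⊥-elim (p∤d e∣d)

  module _ {m : ℕ} .{{_ : NonZero m}} where

    unit⇒coprime : ∀ {u w} → u * w ≈ 1 ⟨mod m ⟩ → Coprime u m
    unit⇒coprime {u} {w} uw≈1 {d} (d∣u , d∣m) with ≈⇒≡[mod] uw≈1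
    ... | q , r , eq = ∣1⇒≡1 (∣m+n∣m⇒∣n (subst (d ∣_) (trans eq (+-comm 1 (r * m)))
                        (∣m∣n⇒∣m+n (∣m⇒∣m*n w d∣u) (∣n⇒∣m*n q d∣m))) (∣n⇒∣m*n r d∣m))

  coprime⇒inverse : ∀ {m} .{{_ : NonZero m}} {u} → Coprime u m → ∃[ w ] u * w ≈ 1 ⟨mod m ⟩
  coprime⇒inverse {suc m′} {u} c with coprime-Bézout c
  ... | Bézout.+- x y eq = x , ≈-trans (≈-reflexive (trans (*-comm u x) (sym eq))) (+k*m-≈ 1 y)
  -- From 1 + x u = y m, the inverse of u is −x ≡ x (m − 1).
  ... | Bézout.-+ x y eq = x * m′ , (begin
    u * (x * m′)                    ≈⟨ +k*m-≈ (u * (x * m′)) 1 ⟨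
    u * (x * m′) + 1 * suc m′       ≡⟨ regroup u x m′ ⟩
    1 + (1 + x * u) * m′            ≡⟨ cong (λ t → 1 + t * m′) eq ⟩
    1 + y * suc m′ * m′             ≡⟨ cong (1 +_) (xy∙z≈xz∙y y (suc m′) m′) ⟩
    1 + y * m′ * suc m′             ≈⟨ +k*m-≈ 1 (y * m′) ⟩
    1                               ∎)
    where
    open ≈-Reasoning (suc m′)
    regroup : ∀ u x m′ → u * (x * m′) + 1 * suc m′ ≡ 1 + (1 + x * u) * m′
    regroup = solve-∀

  module _ (m : ℕ) (m≢0 : NonZero m) where
    private instance
      m≢0ᵢ : NonZero m
      m≢0ᵢ = m≢0

    inverse⇒isUnit : ∀ {u w} → u * w ≈ 1 ⟨mod m ⟩ → IsUnit m (red m m≢0 u)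
    inverse⇒isUnit {u} {w} uw≈1 = red m m≢0 w , ≈⇒≡[mod] (≈-trans (*-cong-≈ (red-≈ m m≢0 u) (red-≈ m m≢0 w)) uw≈1)

    red-square : ∀ x → toℕ (red m m≢0 (x * x)) ≡ toℕ (red m m≢0 x) * toℕ (red m m≢0 x) [mod m ]
    red-square x = ≈⇒≡[mod] (≈-trans (red-≈ m m≢0 (x * x))
      (≈-sym (*-cong-≈ (red-≈ m m≢0 x) (red-≈ m m≢0 x))))

    coprime⇒square∈SqUnits : ∀ {x} → Coprime x m → SqUnits m (red m m≢0 (x * x))
    coprime⇒square∈SqUnits {x} c with w , xw≈1 ← coprime⇒inverse c =
      red m m≢0 x , inverse⇒isUnit xw≈1 , red-square x

    1∈SqUnits : SqUnits m (red m m≢0 1)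
    1∈SqUnits = coprime⇒square∈SqUnits {1} (λ (d∣1 , _) → ∣1⇒≡1 d∣1)

    SqUnits-* : ∀ {a b} → SqUnits m a → SqUnits m b → SqUnits m (red m m≢0 (toℕ a * toℕ b))
    SqUnits-* {a} {b} (x , (y , xy≡1) , a≡x²) (x′ , (y′ , x′y′≡1) , b≡x′²) =
      red m m≢0 (toℕ x * toℕ x′) , inverse⇒isUnit xx′yy′≈1 , ≈⇒≡[mod] ab≈[xx′]²
      where
      open ≈-Reasoning m
      xx′yy′≈1 : toℕ x * toℕ x′ * (toℕ y * toℕ y′) ≈ 1 ⟨mod m ⟩
      xx′yy′≈1 = begin
        toℕ x * toℕ x′ * (toℕ y * toℕ y′)     ≡⟨ interchange (toℕ x) (toℕ x′) (toℕ y) (toℕ y′) ⟩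
        toℕ x * toℕ y * (toℕ x′ * toℕ y′)     ≈⟨ *-cong-≈ (≡[mod]⇒≈ xy≡1) (≡[mod]⇒≈ x′y′≡1) ⟩
        1                                     ∎
      ab≈[xx′]² : toℕ (red m m≢0 (toℕ a * toℕ b)) ≈ toℕ (red m m≢0 (toℕ x * toℕ x′)) * toℕ (red m m≢0 (toℕ x * toℕ x′)) ⟨mod m ⟩
      ab≈[xx′]² = begin
        toℕ (red m m≢0 (toℕ a * toℕ b))               ≈⟨ red-≈ m m≢0 _ ⟩
        toℕ a * toℕ b                                 ≈⟨ *-cong-≈ (≡[mod]⇒≈ a≡x²) (≡[mod]⇒≈ b≡x′²) ⟩
        toℕ x * toℕ x * (toℕ x′ * toℕ x′)             ≡⟨ interchange (toℕ x) (toℕ x) (toℕ x′) (toℕ x′) ⟩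
        toℕ x * toℕ x′ * (toℕ x * toℕ x′)             ≈⟨ *-cong-≈ (red-≈ m m≢0 _) (red-≈ m m≢0 _) ⟨
        toℕ (red m m≢0 (toℕ x * toℕ x′)) * toℕ (red m m≢0 (toℕ x * toℕ x′)) ∎

  SqUnits-mod : ∀ {m d} (m≢0 : NonZero m) (d≢0 : NonZero d) → d ∣ m →
                ∀ {a} → SqUnits m a → SqUnits d (red d d≢0 (toℕ a))
  SqUnits-mod {m} {d} m≢0 d≢0 d∣m {a} (x , (y , xy≡1) , a≡x²) =
    red d d≢0 (toℕ x) , inverse⇒isUnit d d≢0 xy≈1 , ≈⇒≡[mod] a≈x²
    where
    instance
      m≢0ᵢ : NonZero m
      m≢0ᵢ = m≢0
      d≢0ᵢ : NonZero d
      d≢0ᵢ = d≢0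
    open ≈-Reasoning d
    xy≈1 : toℕ x * toℕ y ≈ 1 ⟨mod d ⟩
    xy≈1 = ≈-divisor d d∣m (≡[mod]⇒≈ xy≡1)
    a≈x² : toℕ (red d d≢0 (toℕ a)) ≈ toℕ (red d d≢0 (toℕ x)) * toℕ (red d d≢0 (toℕ x)) ⟨mod d ⟩
    a≈x² = begin
      toℕ (red d d≢0 (toℕ a))                             ≈⟨ red-≈ d d≢0 _ ⟩
      toℕ a                                               ≈⟨ ≈-divisor d d∣m (≡[mod]⇒≈ a≡x²) ⟩
      toℕ x * toℕ x                                       ≈⟨ *-cong-≈ (red-≈ d d≢0 _) (red-≈ d d≢0 _) ⟨
      toℕ (red d d≢0 (toℕ x)) * toℕ (red d d≢0 (toℕ x))   ∎

  chinese-remainder : ∀ {p m} .{{_ : NonZero p}} .{{_ : NonZero m}} → Coprime p m →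
                      ∀ x y → ∃[ X ] X ≈ x ⟨mod p ⟩ × X ≈ y ⟨mod m ⟩
  chinese-remainder {p} {m} c x y with w , pw≈1 ← coprime⇒inverse c =
    x + p * (w * (y + pred m * x)) , X≈x , X≈y
    where
    X≈x : x + p * (w * (y + pred m * x)) ≈ x ⟨mod p ⟩
    X≈x = ≈-trans (≈-reflexive (cong (x +_) (*-comm p _))) (+k*m-≈ x (w * (y + pred m * x)))
    X≈y : x + p * (w * (y + pred m * x)) ≈ y ⟨mod m ⟩
    X≈y = begin
      x + p * (w * (y + pred m * x))   ≡⟨ cong (x +_) (*-assoc p w _) ⟨
      x + p * w * (y + pred m * x)     ≈⟨ +-cong-≈ (≈-refl {a = x}) (*-cong-≈ pw≈1 (≈-refl {a = y + pred m * x})) ⟩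
      x + 1 * (y + pred m * x)         ≡⟨ collect x y (pred m) ⟩
      y + x * suc (pred m)             ≡⟨ cong (λ t → y + x * t) (suc-pred m) ⟩
      y + x * m                        ≈⟨ +k*m-≈ y x ⟩
      y                                ∎
      where
      open ≈-Reasoning m
      collect : ∀ x y m′ → x + 1 * (y + m′ * x) ≡ y + x * suc m′
      collect = solve-∀

  module Lifting {p n′ n : ℕ} (pr : Prime p) (n≡pn′ : n ≡ p * n′) .{{_ : NonZero n′}} .{{_ : NonZero n}} where

    private instance
      p≢0 : NonZero p
      p≢0 = prime⇒nonZero pr

    coprime-lift : ∀ {y} → p ∤ y → Coprime y n′ → Coprime y n
    coprime-lift p∤y c {d} (d∣y , d∣n) =
      c (d∣y , coprime-divisor (∤⇒coprime pr (p∤y ∘ flip ∣-trans d∣y)) (subst (d ∣_) n≡pn′ d∣n))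

    lift-unit : ∀ {y w} → y * w ≈ 1 ⟨mod n′ ⟩ → ∃[ Y ] Coprime Y n × Y ≈ y ⟨mod n′ ⟩
    lift-unit {y} {w} yw≈1 with p ∣? y
    ... | no p∤y = y , coprime-lift p∤y (unit⇒coprime yw≈1) , ≈-refl
    ... | yes p∣y = y + n′ , coprime-lift p∤y+n′ (unit⇒coprime {w = w} [y+n′]w≈1) , y+n′≈y
      where
      y+n′≈y : y + n′ ≈ y ⟨mod n′ ⟩
      y+n′≈y = mk ([m+n]%n≡m%n y n′)
      [y+n′]w≈1 : (y + n′) * w ≈ 1 ⟨mod n′ ⟩
      [y+n′]w≈1 = ≈-trans (*-cong-≈ y+n′≈y ≈-refl) yw≈1
      p∤n′ : p ∤ n′
      p∤n′ p∣n′ = ¬prime[1] (subst Prime (unit⇒coprime yw≈1 (p∣y , p∣n′)) pr)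
      p∤y+n′ : p ∤ y + n′
      p∤y+n′ p∣y+n′ = p∤n′ (∣m+n∣m⇒∣n p∣y+n′ p∣y)

    -- m with every factor p divided out, provided the fuel f is at least m.
    p-free : ℕ → ℕ → ℕ
    p-free zero m = m
    p-free (suc f) m with p ∣? m
    ... | yes _ = p-free f (m / p)
    ... | no _ = m

    p∤p-free : ∀ f m → 1 ≤ m → m ≤ f → p ∤ p-free f m
    p∤p-free zero (suc m) _ ()
    p∤p-free (suc f) m 1≤m m≤1+f with p ∣? m
    ... | no p∤m = p∤m
    ... | yes p∣m = p∤p-free f (m / p) 1≤m/p m/p≤f
      where
      instance
        m≢0 : NonZero m
        m≢0 = >-nonZero 1≤m
      1≤m/p : 1 ≤ m / p
      1≤m/p = m≥n⇒m/n>0 (∣⇒≤ p∣m)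
      m/p≤f : m / p ≤ f
      m/p≤f = ≤-pred (<-≤-trans (m/n<m m p (nonTrivial⇒n>1 p {{prime⇒nonTrivial pr}})) m≤1+f)

    coprime-∣-p-free : ∀ f m {d} → Coprime d p → d ∣ m → d ∣ p-free f m
    coprime-∣-p-free zero m c d∣m = d∣m
    coprime-∣-p-free (suc f) m c d∣m with p ∣? m
    ... | no _ = d∣m
    ... | yes p∣m = coprime-∣-p-free f (m / p) c (coprime-divisor c (subst (_ ∣_) (sym (m*[n/m]≡n p∣m)) d∣m))

    coprime-lift-mod-p : ∀ {X x m} .{{_ : NonZero m}} → p ∤ x → X ≈ x ⟨mod p ⟩ → X ≈ 1 ⟨mod m ⟩ →
                         (∀ {d} → Coprime d p → d ∣ n′ → d ∣ m) → Coprime X n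
    coprime-lift-mod-p {X} {x} p∤x X≈x X≈1 ∣m {d} (d∣X , d∣n) with p ∣? d
    ... | yes p∣d = ⊥-elim (p∤x (≈0⇒∣ (≈-trans (≈-sym X≈x) (∣⇒≈0 (∣-trans p∣d d∣X)))))
    ... | no p∤d = ∣1⇒≡1 (≈0⇒∣ (≈-trans (≈-sym (≈-divisor d d∣m X≈1)) (∣⇒≈0 d∣X)))
      where
      instance
        d≢0 : NonZero d
        d≢0 = ≢-nonZero λ d≡0 → ≢-nonZero⁻¹ n (0∣⇒≡0 (subst (_∣ n) d≡0 d∣n))
      d∣m : d ∣ _
      d∣m = ∣m (∤⇒coprime pr p∤d) (coprime-divisor (∤⇒coprime pr p∤d) (subst (d ∣_) n≡pn′ d∣n))

    n₀ : ℕ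
    n₀ = p-free n′ n′

    p∤n₀ : p ∤ n₀
    p∤n₀ = p∤p-free n′ n′ (n≢0⇒n>0 (≢-nonZero⁻¹ n′)) ≤-refl

    private instance
      n₀≢0 : NonZero n₀
      n₀≢0 = ≢-nonZero λ n₀≡0 → p∤n₀ (subst (p ∣_) (sym n₀≡0) (p ∣0))

    lift-mod-p : ∀ {x} → p ∤ x → ∃[ X ] Coprime X n × X ≈ x ⟨mod p ⟩
    lift-mod-p {x} p∤x with X , X≈x , X≈1 ← chinese-remainder (sym-coprime (∤⇒coprime pr p∤n₀)) x 1 =
      X , coprime-lift-mod-p p∤x X≈x X≈1 (coprime-∣-p-free n′ n′) , X≈x

module ListSplitting where

  open import Data.Nat using (suc; _+_; _*_)
  open import Data.Nat.Tactic.RingSolver using (solve-∀)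
  open import Data.List using (List; []; _∷_; _++_; map; length)
  open import Data.List.Properties using (∷-injectiveˡ; ∷-injectiveʳ; length-++; length-map)
  open import Data.List.Relation.Unary.All using (All; []; _∷_)
  open import Data.Product using (∃-syntax; _×_; _,_)
  open import Data.Sum using (_⊎_; inj₁; inj₂)
  open import Relation.Binary.PropositionalEquality
  open import Relation.Nullary using (¬_; contradiction)

  map-++⁻ : ∀ {A B : Set} (f : A → B) xs {ys zs} → map f xs ≡ ys ++ zs →
            ∃[ xs₁ ] ∃[ xs₂ ] xs ≡ xs₁ ++ xs₂ × map f xs₁ ≡ ys × map f xs₂ ≡ zs
  map-++⁻ f xs {[]} eq = [] , xs , refl , refl , eq
  map-++⁻ f (x ∷ xs) {y ∷ ys} eq with xs₁ , xs₂ , xs≡ , eq₁ , eq₂ ← map-++⁻ f xs (∷-injectiveʳ eq) =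
    x ∷ xs₁ , xs₂ , cong (x ∷_) xs≡ , cong₂ _∷_ (∷-injectiveˡ eq) eq₁ , eq₂

  length-three-runs : ∀ {A B : Set} (f : A → B) us vs ws {x x′} → length vs ≡ length us → length ws ≡ length us →
                      suc (length (map f us ++ x ∷ map f vs ++ x′ ∷ map f ws)) ≡ 3 * suc (length us)
  length-three-runs f us vs ws {x} {x′} |vs|≡|us| |ws|≡|us| = begin
    suc (length (map f us ++ x ∷ map f vs ++ x′ ∷ map f ws))
      ≡⟨ cong suc (length-++ (map f us)) ⟩
    suc (length (map f us) + suc (length (map f vs ++ x′ ∷ map f ws)))
      ≡⟨ cong (λ l → suc (length (map f us) + suc l)) (length-++ (map f vs)) ⟩
    suc (length (map f us) + suc (length (map f vs) + suc (length (map f ws))))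
      ≡⟨ cong₂ (λ a b → suc (length (map f us) + suc (a + suc b)))
           (trans (length-map f vs) |vs|≡|us|) (trans (length-map f ws) |ws|≡|us|) ⟩
    suc (length (map f us) + suc (length us + suc (length us)))
      ≡⟨ cong (λ a → suc (a + suc (length us + suc (length us)))) (length-map f us) ⟩
    suc (length us + suc (length us + suc (length us)))
      ≡⟨ triple (length us) ⟩
    3 * suc (length us) ∎
    where
    open ≡-Reasoning
    triple : ∀ k → suc (k + suc (k + suc k)) ≡ 3 * suc k
    triple = solve-∀

  module _ {A : Set} {P : A → Set} where

    prefix-before : ∀ ys cs l {e} r → All P ys → ¬ P e → ys ++ cs ≡ l ++ e ∷ r → ∃[ cs′ ] l ≡ ys ++ cs′
    prefix-before [] cs l r _ _ _ = l , refl
    prefix-before (y ∷ ys) cs [] r (py ∷ _) ¬pe eq = contradiction (subst P (∷-injectiveˡ eq) py) ¬pe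
    prefix-before (y ∷ ys) cs (l ∷ ls) r (_ ∷ pys) ¬pe eq
      with cs′ , ls≡ ← prefix-before ys cs ls r pys ¬pe (∷-injectiveʳ eq) =
      cs′ , cong₂ _∷_ (sym (∷-injectiveˡ eq)) ls≡

    block-before-or-after : ∀ as ys cs l {e} r → All P ys → ¬ P e →
      as ++ ys ++ cs ≡ l ++ e ∷ r → (∃[ cs′ ] l ≡ as ++ ys ++ cs′) ⊎ (∃[ as′ ] r ≡ as′ ++ ys ++ cs)
    block-before-or-after [] ys cs l r pys ¬pe eq = inj₁ (prefix-before ys cs l r pys ¬pe eq)
    block-before-or-after (a ∷ as) ys cs [] r _ _ eq = inj₂ (as , sym (∷-injectiveʳ eq))
    block-before-or-after (a ∷ as) ys cs (l ∷ ls) r pys ¬pe eq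
      with block-before-or-after as ys cs ls r pys ¬pe (∷-injectiveʳ eq)
    ... | inj₁ (cs′ , ls≡) = inj₁ (cs′ , cong₂ _∷_ (sym (∷-injectiveˡ eq)) ls≡)
    ... | inj₂ after = inj₂ after

module ZeroSumBlocks where

  open import Defs
  open import Data.Nat
  open import Data.Nat.Properties
  open import Data.Fin using (Fin; toℕ)
  open import Data.List using (List; []; _∷_; _++_; length; take; drop)
  open import Data.List.Properties using (length-take; take++drop≡id; ++-assoc)
  open import Data.Product using (_,_)
  open import Relation.Binary.PropositionalEquality
  open import Relation.Nullary using (¬_)

  wsum-++ : ∀ {m} (bs xs : List (Fin m)) {bs′ xs′} → length bs ≡ length xs →
            wsum (bs ++ bs′) (xs ++ xs′) ≡ wsum bs xs + wsum bs′ xs′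
  wsum-++ [] [] _ = refl
  wsum-++ (b ∷ bs) (x ∷ xs) eq =
    trans (cong (toℕ b * toℕ x +_) (wsum-++ bs xs (suc-injective eq))) (sym (+-assoc (toℕ b * toℕ x) _ _))

  module _ {m : ℕ} {B : Fin m → Set} where

    block-infix : ∀ xs {ys} zs → HasWZSBlock m B ys → HasWZSBlock m B (xs ++ ys ++ zs)
    block-infix xs {ys} zs (as , bs , cs , ys≡ , zero-sum) = xs ++ as , bs , cs ++ zs , (begin
      xs ++ ys ++ zs                  ≡⟨ cong (λ l → xs ++ l ++ zs) ys≡ ⟩
      xs ++ (as ++ bs ++ cs) ++ zs    ≡⟨ cong (xs ++_) (++-assoc as (bs ++ cs) zs) ⟩
      xs ++ as ++ (bs ++ cs) ++ zs    ≡⟨ cong (λ l → xs ++ as ++ l) (++-assoc bs cs zs) ⟩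
      xs ++ as ++ bs ++ cs ++ zs      ≡⟨ ++-assoc xs as (bs ++ cs ++ zs) ⟨
      (xs ++ as) ++ bs ++ cs ++ zs    ∎) , zero-sum
      where open ≡-Reasoning

    blockless⇒¬AllHaveBlock : ∀ {xs} → ¬ HasWZSBlock m B xs → ∀ k → k ≤ length xs → ¬ AllHaveBlock m B k
    blockless⇒¬AllHaveBlock {xs} no-block k k≤ all-have =
      no-block (subst (HasWZSBlock m B) (take++drop≡id k xs)
        (block-infix [] (drop k xs) (all-have (take k xs) (trans (length-take k xs) (m≤n⇒m⊓n≡m k≤)))))

    extremal-from : ∀ {xs} → ¬ HasWZSBlock m B xs → AllHaveBlock m B (suc (length xs)) → Extremal m B xs
    extremal-from {xs} no-block all-have =
      (suc (length xs) , (s≤s z≤n , all-have , λ k _ k< → blockless⇒¬AllHaveBlock no-block k (≤-pred k<)) , refl) , no-block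

    extremal⇒AllHaveBlock : ∀ {xs} → Extremal m B xs → AllHaveBlock m B (suc (length xs))
    extremal⇒AllHaveBlock ((c , (_ , all-have , _) , c≡) , _) = subst (AllHaveBlock m B) (sym c≡) all-have

open import Relation.Unary using (Decidable)

module Segmentation {A : Set} {Z : A → Set} (Z? : Decidable Z) where

  open import Data.Nat using (ℕ; zero; suc; _+_; _*_; _≤_; _<_; z≤n; s≤s; _≤?_)
  open import Data.Nat.Properties
  open import Data.Nat.Tactic.RingSolver using (solve-∀)
  open import Data.List using (List; []; _∷_; [_]; _++_; length; concat; filter; take; drop)
  open import Data.List.Properties using (filter-++; filter-accept; filter-reject; length-++; ++-assoc;
    take++drop≡id; concat-++; length-take)
  open import Data.List.Relation.Unary.All using (All; []; _∷_)
  open import Data.List.Relation.Unary.All.Properties using (take⁺)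
  open import Data.Product using (∃-syntax; _×_; _,_)
  open import Data.Empty using (⊥; ⊥-elim)
  open import Function using (_∘_)
  open import Relation.Binary.PropositionalEquality hiding ([_])
  open import Relation.Nullary using (¬_; yes; no; ¬?)

  nonzeros : List A → List A
  nonzeros = filter (¬? ∘ Z?)

  data Segment : List A → Set where
    zero-singleton : ∀ {z} → Z z → Segment [ z ]
    three-nonzeros : ∀ {seg} → length (nonzeros seg) ≡ 3 → Segment seg

  Tiling : List A → ℕ → Set
  Tiling w c = ∃[ segs ] ∃[ post ] w ≡ concat segs ++ post × c ≤ length segs × All Segment segs

  Decomposition : List A → ℕ → Set
  Decomposition w c = ∃[ pre ] ∃[ rest ] w ≡ pre ++ rest × Tiling rest c

  -- A greedy left-to-right scan: at a boundary a zero is a segment by itself, an open segment is closed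
  -- by its third nonzero, and the skipping phases discard one or two nonzeros before the first boundary.
  data Phase : Set where
    boundary open₁ open₂ skip₁ skip₂ : Phase

  count : Phase → List A → ℕ
  count _ [] = 0
  count boundary (x ∷ w) with Z? x
  ... | yes _ = suc (count boundary w)
  ... | no _ = count open₁ w
  count open₁ (x ∷ w) with Z? x
  ... | yes _ = count open₁ w
  ... | no _ = count open₂ w
  count open₂ (x ∷ w) with Z? x
  ... | yes _ = count open₂ w
  ... | no _ = suc (count boundary w)
  count skip₁ (x ∷ w) with Z? x
  ... | yes _ = count skip₁ w
  ... | no _ = count boundary w
  count skip₂ (x ∷ w) with Z? x
  ... | yes _ = count skip₂ w
  ... | no _ = count skip₁ w

  length≤open-counts : ∀ w → length w ≤ count boundary w + count open₁ w + count open₂ w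
  length≤open-counts [] = z≤n
  length≤open-counts (x ∷ w) with Z? x
  ... | yes _ = s≤s (length≤open-counts w)
  ... | no _ = ≤-trans (s≤s (length≤open-counts w)) (≤-reflexive (rotate (count boundary w) (count open₁ w) (count open₂ w)))
    where
    rotate : ∀ a b c → suc (a + b + c) ≡ b + c + suc a
    rotate = solve-∀

  length≤skip₁-counts : ∀ w → length w ≤ count open₁ w + count boundary w + count skip₁ w + 1
  length≤skip₁-counts [] = z≤n
  length≤skip₁-counts (x ∷ w) with Z? x
  ... | yes _ = ≤-trans (s≤s (length≤skip₁-counts w)) (≤-reflexive (shift (count open₁ w) (count boundary w) (count skip₁ w)))
    where
    shift : ∀ a b c → suc (a + b + c + 1) ≡ a + suc b + c + 1
    shift = solve-∀
  ... | no _ = ≤-trans (s≤s (length≤open-counts w)) (≤-reflexive (rotate (count boundary w) (count open₁ w) (count open₂ w)))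
    where
    rotate : ∀ a b c → suc (a + b + c) ≡ c + b + a + 1
    rotate = solve-∀

  length≤skip-counts : ∀ w → length w ≤ count boundary w + count skip₁ w + count skip₂ w + 2
  length≤skip-counts [] = z≤n
  length≤skip-counts (x ∷ w) with Z? x
  ... | yes _ = s≤s (length≤skip-counts w)
  ... | no _ = ≤-trans (s≤s (length≤skip₁-counts w)) (≤-reflexive (shift (count open₁ w) (count boundary w) (count skip₁ w)))
    where
    shift : ∀ a b c → suc (a + b + c + 1) ≡ a + b + c + 2
    shift = solve-∀

  nonzeros-snoc-zero : ∀ cur {x} → Z x → length (nonzeros (cur ++ [ x ])) ≡ length (nonzeros cur)
  nonzeros-snoc-zero cur {x} zx = begin
    length (nonzeros (cur ++ [ x ]))          ≡⟨ cong length (filter-++ (¬? ∘ Z?) cur [ x ]) ⟩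
    length (nonzeros cur ++ nonzeros [ x ])   ≡⟨ length-++ (nonzeros cur) ⟩
    length (nonzeros cur) + length (nonzeros [ x ])
      ≡⟨ cong (λ l → length (nonzeros cur) + length l) (filter-reject (¬? ∘ Z?) (λ ¬zx → ¬zx zx)) ⟩
    length (nonzeros cur) + 0                 ≡⟨ +-identityʳ _ ⟩
    length (nonzeros cur)                     ∎
    where open ≡-Reasoning

  nonzeros-snoc-nonzero : ∀ cur {x} → ¬ Z x → length (nonzeros (cur ++ [ x ])) ≡ suc (length (nonzeros cur))
  nonzeros-snoc-nonzero cur {x} ¬zx = begin
    length (nonzeros (cur ++ [ x ]))          ≡⟨ cong length (filter-++ (¬? ∘ Z?) cur [ x ]) ⟩
    length (nonzeros cur ++ nonzeros [ x ])   ≡⟨ length-++ (nonzeros cur) ⟩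
    length (nonzeros cur) + length (nonzeros [ x ])
      ≡⟨ cong (λ l → length (nonzeros cur) + length l) (filter-accept (¬? ∘ Z?) ¬zx) ⟩
    length (nonzeros cur) + 1                 ≡⟨ +-comm _ 1 ⟩
    suc (length (nonzeros cur))               ∎
    where open ≡-Reasoning

  no-tiles : ∀ w → Tiling w 0
  no-tiles w = [] , w , refl , z≤n , []

  -- cur is the part of the current segment scanned so far.
  Partial : Phase → List A → Set
  Partial boundary cur = cur ≡ []
  Partial open₁ cur = length (nonzeros cur) ≡ 1
  Partial open₂ cur = length (nonzeros cur) ≡ 2
  Partial skip₁ _ = ⊥
  Partial skip₂ _ = ⊥

  snoc-assoc : ∀ cur x (w : List A) → cur ++ x ∷ w ≡ (cur ++ [ x ]) ++ w
  snoc-assoc cur x w = sym (++-assoc cur [ x ] w)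

  tiling : ∀ s cur w c → Partial s cur → c ≤ count s w → Tiling (cur ++ w) c
  tiling s cur w zero _ _ = no-tiles (cur ++ w)
  tiling boundary _ (x ∷ w) (suc c) refl c<count with Z? x
  ... | yes zx with segs , post , w≡ , c≤ , all ← tiling boundary [] w c refl (≤-pred c<count) =
    [ x ] ∷ segs , post , cong (x ∷_) w≡ , s≤s c≤ , zero-singleton zx ∷ all
  ... | no ¬zx = tiling open₁ [ x ] w (suc c) (nonzeros-snoc-nonzero [] ¬zx) c<count
  tiling open₁ cur (x ∷ w) (suc c) one c<count with Z? x
  ... | yes zx = subst (λ v → Tiling v (suc c)) (sym (snoc-assoc cur x w))
    (tiling open₁ (cur ++ [ x ]) w (suc c) (trans (nonzeros-snoc-zero cur zx) one) c<count)
  ... | no ¬zx = subst (λ v → Tiling v (suc c)) (sym (snoc-assoc cur x w))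
    (tiling open₂ (cur ++ [ x ]) w (suc c) (trans (nonzeros-snoc-nonzero cur ¬zx) (cong suc one)) c<count)
  tiling open₂ cur (x ∷ w) (suc c) two c<count with Z? x
  ... | yes zx = subst (λ v → Tiling v (suc c)) (sym (snoc-assoc cur x w))
    (tiling open₂ (cur ++ [ x ]) w (suc c) (trans (nonzeros-snoc-zero cur zx) two) c<count)
  ... | no ¬zx with segs , post , w≡ , c≤ , all ← tiling boundary [] w c refl (≤-pred c<count) =
    (cur ++ [ x ]) ∷ segs , post ,
    trans (snoc-assoc cur x w) (trans (cong ((cur ++ [ x ]) ++_) w≡) (sym (++-assoc (cur ++ [ x ]) (concat segs) post))) ,
    s≤s c≤ , three-nonzeros (trans (nonzeros-snoc-nonzero cur ¬zx) (cong suc two)) ∷ all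

  skip-head : ∀ {x w c} → Decomposition w c → Decomposition (x ∷ w) c
  skip-head {x} (pre , rest , w≡ , t) = x ∷ pre , rest , cong (x ∷_) w≡ , t

  decomposition-skip₁ : ∀ w c → c ≤ count skip₁ w → Decomposition w c
  decomposition-skip₁ w zero _ = [] , w , refl , no-tiles w
  decomposition-skip₁ (x ∷ w) (suc c) c<count with Z? x
  ... | yes _ = skip-head (decomposition-skip₁ w (suc c) c<count)
  ... | no _ = [ x ] , w , refl , tiling boundary [] w (suc c) refl c<count

  decomposition-skip₂ : ∀ w c → c ≤ count skip₂ w → Decomposition w c
  decomposition-skip₂ w zero _ = [] , w , refl , no-tiles w
  decomposition-skip₂ (x ∷ w) (suc c) c<count with Z? x
  ... | yes _ = skip-head (decomposition-skip₂ w (suc c) c<count)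
  ... | no _ = skip-head (decomposition-skip₁ w (suc c) c<count)

  -- Averaging: the three scans starting at offsets 0, 1, 2 together find at least length w − 2 segments.
  decomposition : ∀ w c → 3 * c ≤ length w → Decomposition w c
  decomposition w c 3c≤ with c ≤? count boundary w | c ≤? count skip₁ w | c ≤? count skip₂ w
  ... | yes c≤ | _ | _ = [] , w , refl , tiling boundary [] w c refl c≤
  ... | no _ | yes c≤ | _ = decomposition-skip₁ w c c≤
  ... | no _ | no _ | yes c≤ = decomposition-skip₂ w c c≤
  ... | no c≰₀ | no c≰₁ | no c≰₂ = ⊥-elim (<-irrefl refl (<-≤-trans counts<3c (≤-trans 3c≤ (length≤skip-counts w))))
    where
    counts<3c : count boundary w + count skip₁ w + count skip₂ w + 2 < 3 * c
    counts<3c = <-≤-trans (≤-reflexive (rearrange (count boundary w) (count skip₁ w) (count skip₂ w)))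
                  (≤-trans (+-mono-≤ (+-mono-≤ (≰⇒> c≰₀) (≰⇒> c≰₁)) (≰⇒> c≰₂)) (≤-reflexive (triple c)))
      where
      rearrange : ∀ a b d → suc (a + b + d + 2) ≡ suc a + suc b + suc d
      rearrange = solve-∀
      triple : ∀ c → c + c + c ≡ 3 * c
      triple = solve-∀

  segments : ∀ w c → 3 * c ≤ length w →
    ∃[ pre ] ∃[ segs ] ∃[ post ] w ≡ pre ++ concat segs ++ post × length segs ≡ c × All Segment segs
  segments w c 3c≤ with pre , rest , w≡ , segs , post , rest≡ , c≤ , all ← decomposition w c 3c≤ =
    pre , take c segs , concat (drop c segs) ++ post , w≡′ , trans (length-take c segs) (m≤n⇒m⊓n≡m c≤) , take⁺ c all
    where
    w≡′ : w ≡ pre ++ concat (take c segs) ++ concat (drop c segs) ++ post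
    w≡′ = begin
      w                                                        ≡⟨ w≡ ⟩
      pre ++ rest                                              ≡⟨ cong (pre ++_) rest≡ ⟩
      pre ++ concat segs ++ post                               ≡⟨ cong (λ s → pre ++ concat s ++ post) (take++drop≡id c segs) ⟨
      pre ++ concat (take c segs ++ drop c segs) ++ post
        ≡⟨ cong (λ l → pre ++ l ++ post) (concat-++ (take c segs) (drop c segs)) ⟨
      pre ++ (concat (take c segs) ++ concat (drop c segs)) ++ post ≡⟨ cong (pre ++_) (++-assoc (concat (take c segs)) _ post) ⟩
      pre ++ concat (take c segs) ++ concat (drop c segs) ++ post ∎
      where open ≡-Reasoning

open import Data.Nat using (ℕ; NonZero; _*_)
open import Data.Nat.Primality using (Prime)
open import Relation.Binary.PropositionalEquality using (_≡_)

module ExtremalExtension {n p n′ : ℕ} (n≢0 : NonZero n) (pr : Prime p) (n≡pn′ : n ≡ p * n′) where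

  open import Defs
  open Congruence
  open SquaresOfUnits
  open ListSplitting
  open ZeroSumBlocks using (block-infix; wsum-++)
  open DiagonalTernaryForms using (ternary-unit-solution)
  open import Data.Nat
  open import Data.Nat.Properties
  open import Data.Nat.Tactic.RingSolver using (solve-∀)
  open import Algebra.Properties.CommutativeSemigroup *-commutativeSemigroup using (x∙yz≈y∙xz)
  open import Data.Nat.Divisibility hiding (quotient)
  open import Data.Nat.Primality using (prime⇒nonZero)
  open import Data.Nat.Coprimality using (Coprime)
  open import Data.Nat.DivMod using (_/_; m*[n/m]≡n)
  open import Data.Fin using (Fin; toℕ)
  open import Data.List using (List; []; _∷_; _++_; map; length; concat)
  open import Data.List.Properties
    using (filter-accept; filter-reject; filter-++; length-map; length-++; map-++; concat-++)
  open import Data.List.Relation.Binary.Pointwise using (Pointwise; []; _∷_; Pointwise-length)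
  open import Data.List.Relation.Unary.All as All using (All; []; _∷_)
  import Data.List.Relation.Unary.All.Properties as All
  open import Data.List.Relation.Binary.Sublist.Propositional using (_⊆_; _∷ʳ_; _∷_; []; ⊆-refl)
  import Data.List.Relation.Binary.Sublist.Propositional.Properties as Sublist
  open import Data.Product using (∃-syntax; _×_; _,_)
  open import Data.Sum using (inj₁; inj₂)
  open import Function using (_∘_)
  open import Relation.Binary.PropositionalEquality
  open import Relation.Nullary using (¬_; yes; no; ¬?; contradiction)
  open import Relation.Unary using (Decidable)

  private instance
    n≢0ᵢ : NonZero n
    n≢0ᵢ = n≢0
    p≢0 : NonZero p
    p≢0 = prime⇒nonZero pr
    n′≢0 : NonZero n′
    n′≢0 = m*n≢0⇒n≢0 p {{subst NonZero n≡pn′ n≢0}}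

  A : Fin n → Set
  A = SqUnits n

  A′ : Fin n′ → Set
  A′ = SqUnits n′

  ι : Fin n′ → Fin n
  ι u = red n n≢0 (p * toℕ u)

  ρ : Fin n → Fin n′
  ρ b = red n′ n′≢0 (toℕ b)

  φ : Fin n → Fin p
  φ x = red p p≢0 (toℕ x)

  p∣n : p ∣ n
  p∣n = subst (p ∣_) (sym n≡pn′) (m∣m*n n′)

  n′∣n : n′ ∣ n
  n′∣n = subst (n′ ∣_) (sym n≡pn′) (n∣m*n p)

  Vanishes : Fin n → Set
  Vanishes x = p ∣ toℕ x

  vanishes? : Decidable Vanishes
  vanishes? x = p ∣? toℕ x

  open Segmentation vanishes? public using (nonzeros; Segment; zero-singleton; three-nonzeros; segments)

  nonzero? : Decidable (¬_ ∘ Vanishes)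
  nonzero? = ¬? ∘ vanishes?

  ι-vanishes : ∀ u → Vanishes (ι u)
  ι-vanishes u = subst (p ∣_) (sym (toℕ-red n n≢0 (p * toℕ u))) (%-presˡ-∣ (m∣m*n (toℕ u)) p∣n)

  nonzeros-ι : ∀ us → nonzeros (map ι us) ≡ []
  nonzeros-ι [] = refl
  nonzeros-ι (u ∷ us) = trans (filter-reject nonzero? (λ ¬v → ¬v (ι-vanishes u))) (nonzeros-ι us)

  nonzeros≡[]⇒vanish : ∀ ys → nonzeros ys ≡ [] → All Vanishes ys
  nonzeros≡[]⇒vanish [] _ = []
  nonzeros≡[]⇒vanish (y ∷ ys) eq with vanishes? y
  ... | yes v = v ∷ nonzeros≡[]⇒vanish ys eq
  ... | no _ with () ← eq

  p*-cong : ∀ {x y} → x ≈ y ⟨mod n′ ⟩ → p * x ≈ p * y ⟨mod n ⟩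
  p*-cong {x} {y} x≈y with q , r , eq ← ≈⇒≡[mod] x≈y = ≡[mod]⇒≈ (q , r , (begin
    p * x + q * n           ≡⟨ cong (λ m → p * x + q * m) n≡pn′ ⟩
    p * x + q * (p * n′)    ≡⟨ factor x q ⟩
    p * (x + q * n′)        ≡⟨ cong (p *_) eq ⟩
    p * (y + r * n′)        ≡⟨ factor y r ⟨
    p * y + r * (p * n′)    ≡⟨ cong (λ m → p * y + r * m) n≡pn′ ⟨
    p * y + r * n           ∎))
    where
    open ≡-Reasoning
    factor : ∀ z k → p * z + k * (p * n′) ≡ p * (z + k * n′)
    factor z k = trans (cong (p * z +_) (x∙yz≈y∙xz k p n′)) (sym (*-distribˡ-+ p z (k * n′)))

  wsum-ι : ∀ bs us → wsum bs (map ι us) ≈ p * wsum (map ρ bs) us ⟨mod n ⟩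
  wsum-ι [] us = ≈-reflexive (sym (*-zeroʳ p))
  wsum-ι (b ∷ bs) [] = ≈-reflexive (sym (*-zeroʳ p))
  wsum-ι (b ∷ bs) (u ∷ us) = begin
    toℕ b * toℕ (ι u) + wsum bs (map ι us)
      ≈⟨ +-cong-≈ (*-cong-≈ (≈-refl {a = toℕ b}) (red-≈ n n≢0 (p * toℕ u))) (wsum-ι bs us) ⟩
    toℕ b * (p * toℕ u) + p * wsum (map ρ bs) us
      ≡⟨ cong (_+ p * wsum (map ρ bs) us) (x∙yz≈y∙xz (toℕ b) p (toℕ u)) ⟩
    p * (toℕ b * toℕ u) + p * wsum (map ρ bs) us
      ≈⟨ +-cong-≈ (p*-cong (*-cong-≈ (≈-sym (red-≈ n′ n′≢0 (toℕ b))) (≈-refl {a = toℕ u}))) ≈-refl ⟩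
    p * (toℕ (ρ b) * toℕ u) + p * wsum (map ρ bs) us
      ≡⟨ *-distribˡ-+ p _ _ ⟨
    p * wsum (map ρ (b ∷ bs)) (u ∷ us) ∎
    where open ≈-Reasoning n

  ι-block-reduces : ∀ us → WZS n A (map ι us) → WZS n′ A′ us
  ι-block-reduces us (ι-us≢[] , bs , len , bs∈A , sum≡0) =
    (λ us≡[] → ι-us≢[] (cong (map ι) us≡[])) , map ρ bs ,
    trans (length-map ρ bs) (trans len (length-map ι us)) ,
    All.map⁺ (All.map (SqUnits-mod n≢0 n′≢0 n′∣n) bs∈A) ,
    ≈⇒≡[mod] (∣⇒≈0 (*-cancelˡ-∣ p pn′∣pW))
    where
    pn′∣pW : p * n′ ∣ p * wsum (map ρ bs) us
    pn′∣pW = subst (_∣ p * wsum (map ρ bs) us) n≡pn′ (≈0⇒∣ (≈-trans (≈-sym (wsum-ι bs us)) (≡[mod]⇒≈ sum≡0)))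

  block-of-ι-run : ∀ us → ¬ HasWZSBlock n′ A′ us → ∀ as ys cs → map ι us ≡ as ++ ys ++ cs → ¬ WZS n A ys
  block-of-ι-run us no-block as ys cs eq zero-sum
    with us₁ , us₂₃ , us≡ , _ , eq₂₃ ← map-++⁻ ι us {as} {ys ++ cs} eq
    with us₂ , us₃ , us₂₃≡ , eq₂ , _ ← map-++⁻ ι us₂₃ {ys} {cs} eq₂₃ =
    no-block (us₁ , us₂ , us₃ , trans us≡ (cong (us₁ ++_) us₂₃≡) , ι-block-reduces us₂ (subst (WZS n A) (sym eq₂) zero-sum))

  nonzero-weights : List (Fin n) → List (Fin n) → List (Fin n)
  nonzero-weights (b ∷ bs) (y ∷ ys) with vanishes? y
  ... | yes _ = nonzero-weights bs ys
  ... | no _ = b ∷ nonzero-weights bs ys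
  nonzero-weights _ _ = []

  nonzero-weights-length : ∀ bs ys → length bs ≡ length ys → length (nonzero-weights bs ys) ≡ length (nonzeros ys)
  nonzero-weights-length [] [] _ = refl
  nonzero-weights-length (b ∷ bs) (y ∷ ys) eq with vanishes? y
  ... | yes _ = nonzero-weights-length bs ys (suc-injective eq)
  ... | no _ = cong suc (nonzero-weights-length bs ys (suc-injective eq))

  nonzero-weights-all : ∀ {P : Fin n → Set} bs ys → All P bs → All P (nonzero-weights bs ys)
  nonzero-weights-all [] ys _ = []
  nonzero-weights-all (b ∷ bs) [] _ = []
  nonzero-weights-all (b ∷ bs) (y ∷ ys) (pb ∷ pbs) with vanishes? y
  ... | yes _ = nonzero-weights-all bs ys pbs
  ... | no _ = pb ∷ nonzero-weights-all bs ys pbs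

  nonzero-weights-sum : ∀ bs ys → length bs ≡ length ys →
    wsum bs ys ≈ wsum (nonzero-weights bs ys) (nonzeros ys) ⟨mod p ⟩
  nonzero-weights-sum [] [] _ = ≈-refl
  nonzero-weights-sum (b ∷ bs) (y ∷ ys) eq with vanishes? y
  ... | yes p∣y = +-cong-≈ (∣⇒≈0 (∣n⇒∣m*n (toℕ b) p∣y)) (nonzero-weights-sum bs ys (suc-injective eq))
  ... | no _ = +-cong-≈ ≈-refl (nonzero-weights-sum bs ys (suc-injective eq))

  φ-wsum : ∀ bs ys → wsum (map φ bs) (map φ ys) ≈ wsum bs ys ⟨mod p ⟩
  φ-wsum [] ys = ≈-refl
  φ-wsum (b ∷ bs) [] = ≈-refl
  φ-wsum (b ∷ bs) (y ∷ ys) = +-cong-≈ (*-cong-≈ (red-≈ p p≢0 _) (red-≈ p p≢0 _)) (φ-wsum bs ys)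

  nonzeros-zero-sum : ∀ ys → WZS n A ys → nonzeros ys ≢ [] → WZS p (SqUnits p) (map φ (nonzeros ys))
  nonzeros-zero-sum ys (_ , bs , len , bs∈A , sum≡0) nz≢[] =
    (λ eq → nz≢[] (map-≡[] eq)) , map φ (nonzero-weights bs ys) ,
    trans (length-map φ (nonzero-weights bs ys)) (trans (nonzero-weights-length bs ys len) (sym (length-map φ (nonzeros ys)))) ,
    All.map⁺ (All.map (SqUnits-mod n≢0 p≢0 p∣n) (nonzero-weights-all bs ys bs∈A)) ,
    ≈⇒≡[mod] (≈-trans (φ-wsum (nonzero-weights bs ys) (nonzeros ys))
      (≈-trans (≈-sym (nonzero-weights-sum bs ys len)) (≈-divisor p p∣n (≡[mod]⇒≈ sum≡0))))
    where
    map-≡[] : ∀ {xs : List (Fin n)} → map φ xs ≡ [] → xs ≡ []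
    map-≡[] {[]} _ = refl

  vanishing-zero-sum : ∀ {x} → Vanishes x → WZS p (SqUnits p) (φ x ∷ [])
  vanishing-zero-sum {x} p∣x = (λ ()) , red p p≢0 1 ∷ [] , refl , 1∈SqUnits p p≢0 ∷ [] ,
    ≈⇒≡[mod] (∣⇒≈0 (∣m∣n⇒∣m+n (∣n⇒∣m*n (toℕ (red p p≢0 1)) p∣φx) (p ∣0)))
    where
    p∣φx : p ∣ toℕ (φ x)
    p∣φx = subst (p ∣_) (sym (toℕ-red p p≢0 (toℕ x))) (%-presˡ-∣ p∣x ∣-refl)

  module _ (us vs ws : List (Fin n′)) {x x′ : Fin n} (x≠0 : ¬ Vanishes x) (x′≠0 : ¬ Vanishes x′) where

    S : List (Fin n)
    S = map ι us ++ x ∷ map ι vs ++ x′ ∷ map ι ws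

    nonzeros-S : nonzeros S ≡ x ∷ x′ ∷ []
    nonzeros-S = begin
      nonzeros S
        ≡⟨ filter-++ nonzero? (map ι us) _ ⟩
      nonzeros (map ι us) ++ nonzeros (x ∷ map ι vs ++ x′ ∷ map ι ws)
        ≡⟨ cong₂ _++_ (nonzeros-ι us) (filter-accept nonzero? x≠0) ⟩
      x ∷ nonzeros (map ι vs ++ x′ ∷ map ι ws)
        ≡⟨ cong (x ∷_) (filter-++ nonzero? (map ι vs) _) ⟩
      x ∷ nonzeros (map ι vs) ++ nonzeros (x′ ∷ map ι ws)
        ≡⟨ cong (x ∷_) (cong₂ _++_ (nonzeros-ι vs) (filter-accept nonzero? x′≠0)) ⟩
      x ∷ x′ ∷ nonzeros (map ι ws)
        ≡⟨ cong (λ l → x ∷ x′ ∷ l) (nonzeros-ι ws) ⟩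
      x ∷ x′ ∷ [] ∎
      where open ≡-Reasoning

    vanishing-block : ¬ HasWZSBlock n′ A′ us → ¬ HasWZSBlock n′ A′ vs → ¬ HasWZSBlock n′ A′ ws →
      ∀ as ys cs → S ≡ as ++ ys ++ cs → All Vanishes ys → ¬ WZS n A ys
    vanishing-block ¬us ¬vs ¬ws as ys cs S≡ ys-vanish
      with block-before-or-after as ys cs (map ι us) _ ys-vanish x≠0 (sym S≡)
    ... | inj₁ (cs′ , us≡) = block-of-ι-run us ¬us as ys cs′ us≡
    ... | inj₂ (as′ , rest≡) with block-before-or-after as′ ys cs (map ι vs) _ ys-vanish x′≠0 (sym rest≡)
    ...   | inj₁ (cs′ , vs≡) = block-of-ι-run vs ¬vs as′ ys cs′ vs≡
    ...   | inj₂ (as″ , ws≡) = block-of-ι-run ws ¬ws as″ ys cs ws≡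

  first-nonvanishing : ∀ {x x′} → ¬ HasWZSSub p (SqUnits p) (φ x ∷ φ x′ ∷ []) → ¬ Vanishes x
  first-nonvanishing {x} {x′} ¬sub v = ¬sub (φ x ∷ [] , refl ∷ (φ x′ ∷ʳ []) , vanishing-zero-sum v)

  second-nonvanishing : ∀ {x x′} → ¬ HasWZSSub p (SqUnits p) (φ x ∷ φ x′ ∷ []) → ¬ Vanishes x′
  second-nonvanishing {x} {x′} ¬sub v = ¬sub (φ x′ ∷ [] , φ x ∷ʳ (refl ∷ []) , vanishing-zero-sum v)

  no-zero-sum-block : ∀ us vs ws x x′ →
    ¬ HasWZSBlock n′ A′ us → ¬ HasWZSBlock n′ A′ vs → ¬ HasWZSBlock n′ A′ ws →
    ¬ HasWZSSub p (SqUnits p) (φ x ∷ φ x′ ∷ []) →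
    ¬ HasWZSBlock n A (map ι us ++ x ∷ map ι vs ++ x′ ∷ map ι ws)
  no-zero-sum-block us vs ws x x′ ¬us ¬vs ¬ws ¬sub (as , ys , cs , S≡ , zero-sum) with nonzeros ys in nz
  ... | [] = vanishing-block us vs ws x≠0 x′≠0 ¬us ¬vs ¬ws as ys cs S≡ (nonzeros≡[]⇒vanish ys nz) zero-sum
    where
    x≠0 : ¬ Vanishes x
    x≠0 = first-nonvanishing ¬sub
    x′≠0 : ¬ Vanishes x′
    x′≠0 = second-nonvanishing ¬sub
  ... | _ ∷ _ = ¬sub (map φ (nonzeros ys) , Sublist.map⁺ φ nonzeros-ys⊆ ,
                      nonzeros-zero-sum ys zero-sum (λ e → contradiction (trans (sym nz) e) λ ()))
    where
    nonzeros-ys⊆ : nonzeros ys ⊆ x ∷ x′ ∷ []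
    nonzeros-ys⊆ = subst (nonzeros ys ⊆_)
      (trans (cong nonzeros (sym S≡)) (nonzeros-S us vs ws (first-nonvanishing ¬sub) (second-nonvanishing ¬sub)))
      (Sublist.filter⁺ nonzero? nonzero? (λ { refl → λ v → v }) (Sublist.++⁺ˡ as (Sublist.++⁺ʳ cs ⊆-refl)))

  one : Fin n
  one = red n n≢0 1

  record DivisibleSum (seg : List (Fin n)) : Set where
    constructor divisible
    field
      nonempty : seg ≢ []
      weights : List (Fin n)
      length-weights : length weights ≡ length seg
      weights∈A : All A weights
      p∣sum : p ∣ wsum weights seg

  spread : List (Fin n) → List (Fin n) → List (Fin n)
  spread ws [] = []
  spread ws (x ∷ seg) with vanishes? x
  ... | yes _ = one ∷ spread ws seg
  spread [] (x ∷ seg) | no _ = one ∷ spread [] seg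
  spread (w ∷ ws) (x ∷ seg) | no _ = w ∷ spread ws seg

  spread-length : ∀ ws seg → length (spread ws seg) ≡ length seg
  spread-length ws [] = refl
  spread-length ws (x ∷ seg) with vanishes? x
  ... | yes _ = cong suc (spread-length ws seg)
  spread-length [] (x ∷ seg) | no _ = cong suc (spread-length [] seg)
  spread-length (w ∷ ws) (x ∷ seg) | no _ = cong suc (spread-length ws seg)

  spread-all : ∀ {ws} seg → All A ws → All A (spread ws seg)
  spread-all [] _ = []
  spread-all (x ∷ seg) ws∈A with vanishes? x
  ... | yes _ = 1∈SqUnits n n≢0 ∷ spread-all seg ws∈A
  spread-all {[]} (x ∷ seg) [] | no _ = 1∈SqUnits n n≢0 ∷ spread-all seg []
  spread-all {w ∷ ws} (x ∷ seg) (w∈A ∷ ws∈A) | no _ = w∈A ∷ spread-all seg ws∈A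

  spread-sum : ∀ ws seg → length ws ≡ length (nonzeros seg) →
               wsum (spread ws seg) seg ≈ wsum ws (nonzeros seg) ⟨mod p ⟩
  spread-sum [] [] _ = ≈-refl
  spread-sum ws (x ∷ seg) eq with vanishes? x
  ... | yes p∣x = +-cong-≈ (∣⇒≈0 (∣n⇒∣m*n (toℕ one) p∣x)) (spread-sum ws seg eq)
  spread-sum (w ∷ ws) (x ∷ seg) eq | no _ = +-cong-≈ ≈-refl (spread-sum ws seg (suc-injective eq))

  spread-divisible : ∀ seg ws → seg ≢ [] → length ws ≡ length (nonzeros seg) → All A ws →
                     p ∣ wsum ws (nonzeros seg) → DivisibleSum seg
  spread-divisible seg ws seg≢[] len ws∈A p∣ =
    divisible seg≢[] (spread ws seg) (spread-length ws seg) (spread-all seg ws∈A)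
      (≈0⇒∣ (≈-trans (spread-sum ws seg len) (∣⇒≈0 p∣)))

  square-weight : ∀ {x} → p ∤ x → ∃[ W ] A W × toℕ W ≈ x * x ⟨mod p ⟩
  square-weight {x} p∤x with X , X-coprime , X≈x ← Lifting.lift-mod-p pr n≡pn′ p∤x =
    red n n≢0 (X * X) , coprime⇒square∈SqUnits n n≢0 X-coprime ,
    ≈-trans (≈-divisor p p∣n (red-≈ n n≢0 (X * X))) (*-cong-≈ X≈x X≈x)

  three-term-sum : ∀ {a b c Wx Wy Wz : Fin n} {x y z} →
    toℕ Wx ≈ x * x ⟨mod p ⟩ → toℕ Wy ≈ y * y ⟨mod p ⟩ → toℕ Wz ≈ z * z ⟨mod p ⟩ →
    p ∣ toℕ a * (x * x) + toℕ b * (y * y) + toℕ c * (z * z) → p ∣ wsum (Wx ∷ Wy ∷ Wz ∷ []) (a ∷ b ∷ c ∷ [])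
  three-term-sum {a} {b} {c} {Wx} {Wy} {Wz} {x} {y} {z} Wx≈x² Wy≈y² Wz≈z² p∣ = ≈0⇒∣ (begin
    toℕ Wx * toℕ a + (toℕ Wy * toℕ b + (toℕ Wz * toℕ c + 0))
      ≈⟨ +-cong-≈ (*-cong-≈ Wx≈x² (≈-refl {a = toℕ a}))
          (+-cong-≈ (*-cong-≈ Wy≈y² (≈-refl {a = toℕ b})) (+-cong-≈ (*-cong-≈ Wz≈z² (≈-refl {a = toℕ c})) (≈-refl {a = 0}))) ⟩
    x * x * toℕ a + (y * y * toℕ b + (z * z * toℕ c + 0))
      ≡⟨ reorder (x * x) (y * y) (z * z) (toℕ a) (toℕ b) (toℕ c) ⟩
    toℕ a * (x * x) + toℕ b * (y * y) + toℕ c * (z * z)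
      ≈⟨ ∣⇒≈0 p∣ ⟩
    0 ∎)
    where
    open ≈-Reasoning p
    reorder : ∀ X Y Z a b c → X * a + (Y * b + (Z * c + 0)) ≡ a * X + b * Y + c * Z
    reorder = solve-∀

  -- The solutions are taken apart by helper functions: `with` on these arithmetic types exhausts memory.
  three-term-weights : 7 ≤ p → ∀ {a b c} → ¬ Vanishes a → ¬ Vanishes b → ¬ Vanishes c →
    ∃[ ws ] length ws ≡ 3 × All A ws × p ∣ wsum ws (a ∷ b ∷ c ∷ [])
  three-term-weights 7≤p {a} {b} {c} a≠0 b≠0 c≠0 =
    from-solution (ternary-unit-solution pr 7≤p {toℕ a} {toℕ b} {toℕ c} a≠0 b≠0 c≠0)
    where
    from-solution : ∃[ x ] ∃[ y ] ∃[ z ] p ∤ x × p ∤ y × p ∤ z × p ∣ toℕ a * (x * x) + toℕ b * (y * y) + toℕ c * (z * z) →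
                    ∃[ ws ] length ws ≡ 3 × All A ws × p ∣ wsum ws (a ∷ b ∷ c ∷ [])
    from-solution (x , y , z , p∤x , p∤y , p∤z , p∣) = from-weights (square-weight p∤x) (square-weight p∤y) (square-weight p∤z)
      where
      from-weights : ∃[ Wx ] A Wx × toℕ Wx ≈ x * x ⟨mod p ⟩ → ∃[ Wy ] A Wy × toℕ Wy ≈ y * y ⟨mod p ⟩ →
                     ∃[ Wz ] A Wz × toℕ Wz ≈ z * z ⟨mod p ⟩ → ∃[ ws ] length ws ≡ 3 × All A ws × p ∣ wsum ws (a ∷ b ∷ c ∷ [])
      from-weights (Wx , Wx∈A , Wx≈x²) (Wy , Wy∈A , Wy≈y²) (Wz , Wz∈A , Wz≈z²) =
        Wx ∷ Wy ∷ Wz ∷ [] , refl , Wx∈A ∷ Wy∈A ∷ Wz∈A ∷ [] , three-term-sum {a} {b} {c} {x = x} {y} {z} Wx≈x² Wy≈y² Wz≈z² p∣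

  segment-divisible : 7 ≤ p → ∀ {seg} → Segment seg → DivisibleSum seg
  segment-divisible _ (zero-singleton {z} p∣z) =
    divisible (λ ()) (one ∷ []) refl (1∈SqUnits n n≢0 ∷ []) (∣m∣n⇒∣m+n (∣n⇒∣m*n (toℕ one) p∣z) (p ∣0))
  segment-divisible 7≤p {seg} (three-nonzeros len) = from-three (nonzeros seg) refl (All.all-filter nonzero? seg) len
    where
    from-three : ∀ l → nonzeros seg ≡ l → All (¬_ ∘ Vanishes) l → length l ≡ 3 → DivisibleSum seg
    from-three (a ∷ b ∷ c ∷ []) nz (a≠0 ∷ b≠0 ∷ c≠0 ∷ []) _ = from-weights (three-term-weights 7≤p a≠0 b≠0 c≠0)
      where
      seg≢[] : seg ≢ []
      seg≢[] refl = contradiction nz λ ()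
      from-weights : ∃[ ws ] length ws ≡ 3 × All A ws × p ∣ wsum ws (a ∷ b ∷ c ∷ []) → DivisibleSum seg
      from-weights (ws , len-ws , ws∈A , p∣) =
        spread-divisible seg ws seg≢[] (trans len-ws (cong length (sym nz))) ws∈A (subst (λ l → p ∣ wsum ws l) (sym nz) p∣)

  infix 4 _∶_
  record Weighted : Set where
    constructor _∶_
    field
      segment : List (Fin n)
      divisible-sum : DivisibleSum segment
    open DivisibleSum divisible-sum public using (weights)

    quotient : ℕ
    quotient = wsum weights segment / p

    sum≡p*quotient : wsum weights segment ≡ p * quotient
    sum≡p*quotient = sym (m*[n/m]≡n (DivisibleSum.p∣sum divisible-sum))
  open Weighted

  residue : Weighted → Fin n′
  residue t = red n′ n′≢0 (quotient t)

  segments-of : List Weighted → List (Fin n)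
  segments-of ts = concat (map segment ts)

  segments-of-++ : ∀ ts us → segments-of (ts ++ us) ≡ segments-of ts ++ segments-of us
  segments-of-++ ts us = trans (cong concat (map-++ segment ts us)) (sym (concat-++ (map segment ts) (map segment us)))

  segments-of-nonempty : ∀ ts → ts ≢ [] → segments-of ts ≢ []
  segments-of-nonempty [] ts≢[] _ = ts≢[] refl
  segments-of-nonempty ((x ∷ _ ∶ _) ∷ _) _ ()
  segments-of-nonempty (([] ∶ d) ∷ _) _ _ = DivisibleSum.nonempty d refl

  lift-weight : ∀ {b} → A′ b → ∃[ β ] A β × toℕ β ≈ toℕ b ⟨mod n′ ⟩
  lift-weight {b} (y , (w , yw≡1) , b≡y²) = from-lift (Lifting.lift-unit pr n≡pn′ (≡[mod]⇒≈ yw≡1))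
    where
    from-lift : ∃[ Y ] Coprime Y n × Y ≈ toℕ y ⟨mod n′ ⟩ → ∃[ β ] A β × toℕ β ≈ toℕ b ⟨mod n′ ⟩
    from-lift (Y , Y-coprime , Y≈y) = red n n≢0 (Y * Y) , coprime⇒square∈SqUnits n n≢0 Y-coprime , (begin
      toℕ (red n n≢0 (Y * Y))   ≈⟨ ≈-divisor n′ n′∣n (red-≈ n n≢0 (Y * Y)) ⟩
      Y * Y                     ≈⟨ *-cong-≈ Y≈y Y≈y ⟩
      toℕ y * toℕ y             ≈⟨ ≡[mod]⇒≈ b≡y² ⟨
      toℕ b                     ∎)
      where open ≈-Reasoning n′

  CongruentWeights : List (Fin n) → List (Fin n′) → Set
  CongruentWeights = Pointwise (λ β b → toℕ β ≈ toℕ b ⟨mod n′ ⟩)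

  lift-weights : ∀ {bs} → All A′ bs → ∃[ βs ] All A βs × CongruentWeights βs bs
  lift-weights [] = [] , [] , []
  lift-weights {b ∷ bs} (b∈A′ ∷ bs∈A′) = cons (lift-weight b∈A′) (lift-weights bs∈A′)
    where
    cons : ∃[ β ] A β × toℕ β ≈ toℕ b ⟨mod n′ ⟩ → ∃[ βs ] All A βs × CongruentWeights βs bs →
           ∃[ βs ] All A βs × CongruentWeights βs (b ∷ bs)
    cons (β , β∈A , β≈b) (βs , βs∈A , βs≈bs) = β ∷ βs , β∈A ∷ βs∈A , β≈b ∷ βs≈bs

  scale : Fin n → List (Fin n) → List (Fin n)
  scale β = map (λ α → red n n≢0 (toℕ β * toℕ α))

  scale-sum : ∀ β αs seg → wsum (scale β αs) seg ≈ toℕ β * wsum αs seg ⟨mod n ⟩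
  scale-sum β [] seg = ≈-reflexive (sym (*-zeroʳ (toℕ β)))
  scale-sum β (α ∷ αs) [] = ≈-reflexive (sym (*-zeroʳ (toℕ β)))
  scale-sum β (α ∷ αs) (x ∷ seg) = begin
    toℕ (red n n≢0 (toℕ β * toℕ α)) * toℕ x + wsum (scale β αs) seg
      ≈⟨ +-cong-≈ (*-cong-≈ (red-≈ n n≢0 (toℕ β * toℕ α)) (≈-refl {a = toℕ x})) (scale-sum β αs seg) ⟩
    toℕ β * toℕ α * toℕ x + toℕ β * wsum αs seg
      ≡⟨ cong (_+ toℕ β * wsum αs seg) (*-assoc (toℕ β) (toℕ α) (toℕ x)) ⟩
    toℕ β * (toℕ α * toℕ x) + toℕ β * wsum αs seg
      ≡⟨ *-distribˡ-+ (toℕ β) _ _ ⟨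
    toℕ β * wsum (α ∷ αs) (x ∷ seg) ∎
    where open ≈-Reasoning n

  combine : List Weighted → List (Fin n) → List (Fin n)
  combine (t ∷ ts) (β ∷ βs) = scale β (weights t) ++ combine ts βs
  combine _ _ = []

  combine-length : ∀ ts βs → length βs ≡ length ts → length (combine ts βs) ≡ length (segments-of ts)
  combine-length [] [] _ = refl
  combine-length (t@(seg ∶ d) ∷ ts) (β ∷ βs) eq = begin
    length (scale β (weights t) ++ combine ts βs)        ≡⟨ length-++ (scale β (weights t)) ⟩
    length (scale β (weights t)) + length (combine ts βs)
      ≡⟨ cong₂ _+_ (trans (length-map _ (weights t)) (DivisibleSum.length-weights d)) (combine-length ts βs (suc-injective eq)) ⟩
    length seg + length (segments-of ts)                 ≡⟨ length-++ seg ⟨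
    length (segments-of (t ∷ ts))                        ∎
    where open ≡-Reasoning

  combine-all : ∀ ts {βs} → All A βs → All A (combine ts βs)
  combine-all [] _ = []
  combine-all (t ∷ ts) [] = []
  combine-all ((_ ∶ d) ∷ ts) (β∈A ∷ βs∈A) =
    All.++⁺ (All.map⁺ (All.map (SqUnits-* n n≢0 β∈A) (DivisibleSum.weights∈A d))) (combine-all ts βs∈A)

  quotient-sum : List Weighted → List (Fin n) → ℕ
  quotient-sum (t ∷ ts) (β ∷ βs) = toℕ β * quotient t + quotient-sum ts βs
  quotient-sum _ _ = 0

  combine-sum : ∀ ts βs → length βs ≡ length ts →
    wsum (combine ts βs) (segments-of ts) ≈ p * quotient-sum ts βs ⟨mod n ⟩
  combine-sum [] [] _ = ≈-reflexive (sym (*-zeroʳ p))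
  combine-sum (t@(seg ∶ d) ∷ ts) (β ∷ βs) eq = begin
    wsum (scale β (weights t) ++ combine ts βs) (seg ++ segments-of ts)
      ≡⟨ wsum-++ (scale β (weights t)) seg (trans (length-map _ (weights t)) (DivisibleSum.length-weights d)) ⟩
    wsum (scale β (weights t)) seg + wsum (combine ts βs) (segments-of ts)
      ≈⟨ +-cong-≈ (scale-sum β (weights t) seg) (combine-sum ts βs (suc-injective eq)) ⟩
    toℕ β * wsum (weights t) seg + p * quotient-sum ts βs
      ≡⟨ cong (λ s → toℕ β * s + p * quotient-sum ts βs) (sum≡p*quotient t) ⟩
    toℕ β * (p * quotient t) + p * quotient-sum ts βs
      ≡⟨ cong (_+ p * quotient-sum ts βs) (x∙yz≈y∙xz (toℕ β) p (quotient t)) ⟩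
    p * (toℕ β * quotient t) + p * quotient-sum ts βs
      ≡⟨ *-distribˡ-+ p _ _ ⟨
    p * quotient-sum (t ∷ ts) (β ∷ βs) ∎
    where open ≈-Reasoning n

  quotient-sum-≈ : ∀ ts {βs bs} → CongruentWeights βs bs → length βs ≡ length ts →
    quotient-sum ts βs ≈ wsum bs (map residue ts) ⟨mod n′ ⟩
  quotient-sum-≈ [] [] _ = ≈-refl
  quotient-sum-≈ (t ∷ ts) (β≈b ∷ βs≈bs) eq =
    +-cong-≈ (*-cong-≈ β≈b (≈-sym (red-≈ n′ n′≢0 (quotient t)))) (quotient-sum-≈ ts βs≈bs (suc-injective eq))

  lifted-zero-sum : ∀ ts → WZS n′ A′ (map residue ts) → WZS n A (segments-of ts)
  lifted-zero-sum ts (residues≢[] , bs , len , bs∈A′ , sum≡0) = from-lift (lift-weights bs∈A′)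
    where
    from-lift : ∃[ βs ] All A βs × CongruentWeights βs bs → WZS n A (segments-of ts)
    from-lift (βs , βs∈A , βs≈bs) =
      segments-of-nonempty ts (λ ts≡[] → residues≢[] (cong (map residue) ts≡[])) ,
      combine ts βs , combine-length ts βs len-βs , combine-all ts βs∈A ,
      ≈⇒≡[mod] (begin
        wsum (combine ts βs) (segments-of ts)   ≈⟨ combine-sum ts βs len-βs ⟩
        p * quotient-sum ts βs                  ≈⟨ p*-cong (≈-trans (quotient-sum-≈ ts βs≈bs len-βs) (≡[mod]⇒≈ sum≡0)) ⟩
        p * 0                                   ≡⟨ *-zeroʳ p ⟩
        0                                       ∎)
      where
      open ≈-Reasoning n
      len-βs : length βs ≡ length ts
      len-βs = trans (Pointwise-length βs≈bs) (trans len (length-map residue ts))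

  residue-block-lifts : ∀ ts → HasWZSBlock n′ A′ (map residue ts) → HasWZSBlock n A (segments-of ts)
  residue-block-lifts ts (as , ys , cs , residues≡ , zero-sum) = split₁ (map-++⁻ residue ts {as} {ys ++ cs} residues≡)
    where
    split₂ : ∀ t₁ {t₂₃} → ts ≡ t₁ ++ t₂₃ →
      ∃[ t₂ ] ∃[ t₃ ] t₂₃ ≡ t₂ ++ t₃ × map residue t₂ ≡ ys × map residue t₃ ≡ cs → HasWZSBlock n A (segments-of ts)
    split₂ t₁ ts≡ (t₂ , t₃ , t₂₃≡ , residues₂≡ , _) =
      segments-of t₁ , segments-of t₂ , segments-of t₃ , segments≡ ,
      lifted-zero-sum t₂ (subst (WZS n′ A′) (sym residues₂≡) zero-sum)
      where
      segments≡ : segments-of ts ≡ segments-of t₁ ++ segments-of t₂ ++ segments-of t₃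
      segments≡ = begin
        segments-of ts                                        ≡⟨ cong segments-of (trans ts≡ (cong (t₁ ++_) t₂₃≡)) ⟩
        segments-of (t₁ ++ t₂ ++ t₃)                          ≡⟨ segments-of-++ t₁ (t₂ ++ t₃) ⟩
        segments-of t₁ ++ segments-of (t₂ ++ t₃)              ≡⟨ cong (segments-of t₁ ++_) (segments-of-++ t₂ t₃) ⟩
        segments-of t₁ ++ segments-of t₂ ++ segments-of t₃    ∎
        where open ≡-Reasoning
    split₁ : ∃[ t₁ ] ∃[ t₂₃ ] ts ≡ t₁ ++ t₂₃ × map residue t₁ ≡ as × map residue t₂₃ ≡ ys ++ cs →
             HasWZSBlock n A (segments-of ts)
    split₁ (t₁ , t₂₃ , ts≡ , _ , residues₂₃≡) = split₂ t₁ ts≡ (map-++⁻ residue t₂₃ {ys} {cs} residues₂₃≡)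

  weigh : 7 ≤ p → ∀ segs → All Segment segs → List Weighted
  weigh 7≤p [] [] = []
  weigh 7≤p (seg ∷ segs) (s ∷ ss) = (seg ∶ segment-divisible 7≤p s) ∷ weigh 7≤p segs ss

  segments-of-weigh : ∀ 7≤p segs ss → segments-of (weigh 7≤p segs ss) ≡ concat segs
  segments-of-weigh 7≤p [] [] = refl
  segments-of-weigh 7≤p (seg ∷ segs) (_ ∷ ss) = cong (seg ++_) (segments-of-weigh 7≤p segs ss)

  length-weigh : ∀ 7≤p segs ss → length (weigh 7≤p segs ss) ≡ length segs
  length-weigh 7≤p [] [] = refl
  length-weigh 7≤p (seg ∷ segs) (_ ∷ ss) = cong suc (length-weigh 7≤p segs ss)

  upper-bound : 7 ≤ p → ∀ c → AllHaveBlock n′ A′ c → ∀ xs → 3 * c ≤ length xs → HasWZSBlock n A xs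
  upper-bound 7≤p c every-c-block xs 3c≤ = from-segments (segments xs c 3c≤)
    where
    from-segments : ∃[ pre ] ∃[ segs ] ∃[ post ] xs ≡ pre ++ concat segs ++ post × length segs ≡ c × All Segment segs →
                    HasWZSBlock n A xs
    from-segments (pre , segs , post , xs≡ , len , segs-ok) =
      subst (HasWZSBlock n A) (sym xs≡) (block-infix pre post
        (subst (HasWZSBlock n A) (segments-of-weigh 7≤p segs segs-ok) (residue-block-lifts ts
          (every-c-block (map residue ts) (trans (length-map residue ts) (trans (length-weigh 7≤p segs segs-ok) len))))))
      where
      ts : List Weighted
      ts = weigh 7≤p segs segs-ok

open import Defs
open import Data.Nat
open import Data.Nat.Properties using (≤-reflexive)
open import Data.Nat.Divisibility using (_∣_)
open import Data.Nat.Primality using (Prime; prime⇒nonZero)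
open import Data.Fin using (Fin; toℕ)
open import Data.List using (List; []; _∷_; _++_; length; map)
open import Data.Product using (proj₂)
open import Relation.Binary.PropositionalEquality
open import Relation.Nullary using (¬_)
open ListSplitting using (length-three-runs)
open ZeroSumBlocks using (extremal-from; extremal⇒AllHaveBlock)

mainTheorem3 : (n : ℕ) (n>1 : 1 < n) → (∀ q → Prime q → q ∣ n → 7 ≤ q) →
    (p : ℕ) (pp : Prime p) → p ∣ n → (n' : ℕ) → n ≡ p * n' →
    (us vs ws : List (Fin n')) →
    length vs ≡ length us → length ws ≡ length us →
    Extremal n' (SqUnits n') us → Extremal n' (SqUnits n') vs → Extremal n' (SqUnits n') ws →
    (x* x** : Fin n) →
    ¬ HasWZSSub p (SqUnits p)
        (red p (prime⇒nonZero pp) (toℕ x*) ∷ red p (prime⇒nonZero pp) (toℕ x**) ∷ []) →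
    Extremal n (SqUnits n)
      (map (λ u → red n (1<⇒nonZero n>1) (p * toℕ u)) us ++ x* ∷
       map (λ v → red n (1<⇒nonZero n>1) (p * toℕ v)) vs ++ x** ∷
       map (λ w → red n (1<⇒nonZero n>1) (p * toℕ w)) ws)
mainTheorem3 n n>1 prime-divisors≥7 p pp p∣n n′ n≡pn′ us vs ws |vs|≡|us| |ws|≡|us| us-ext vs-ext ws-ext x* x** ¬sub =
  extremal-from no-block all-have-block
  where
  open ExtremalExtension (1<⇒nonZero n>1) pp n≡pn′ using (A; ι; no-zero-sum-block; upper-bound)
  S : List (Fin n)
  S = map ι us ++ x* ∷ map ι vs ++ x** ∷ map ι ws
  no-block : ¬ HasWZSBlock n A S
  no-block = no-zero-sum-block us vs ws x* x** (proj₂ us-ext) (proj₂ vs-ext) (proj₂ ws-ext) ¬sub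
  all-have-block : AllHaveBlock n A (suc (length S))
  all-have-block xs |xs|≡ = upper-bound (prime-divisors≥7 p pp p∣n) (suc (length us)) (extremal⇒AllHaveBlock us-ext) xs
    (≤-reflexive (trans (sym (length-three-runs ι us vs ws |vs|≡|us| |ws|≡|us|)) (sym |xs|≡)))
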